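{- Let $G=(V,E)$ be a connected Eulerian digraph and $s\in V$, and consider the chip-firing game on $G$ with sink $s$. Let $\mathcal{M}$ be the set of minimal recurrent configurations and $\mathcal{A}$ the set of maximal acyclic arc sets $A$ of $G$ such that $s$ is the unique vertex of in-degree $0$ in $G[A]$. Then every $c\in\mathcal{M}$ has exactly one firing graph $\mathcal{F}_c$, and the map $\mathcal{M}\to\mathcal{A}$, $c\mapsto$ (arc set of $\mathcal{F}_c$), is well defined and bijective.
   Context: Digraphs are finite and simple; Eulerian means in-degree equals out-degree at every vertex. For $A\subseteq E$, $G[A]$ is the digraph $(V,A)$; $A$ is an acyclic arc set if $G[A]$ has no directed cycle; it is maximal if $A\cup\{e\}$ is not acyclic for every $e\in E\setminus A$. Chip-firing: let $G_s$ be $G$ with all arcs of tail $s$ deleted. A configuration is a map $c:V\setminus\{s\}\to\mathbb{N}$. A vertex $v\neq s$ is active if $c(v)\ge\mathrm{outdeg}_G(v)\ge1$; firing $v$ subtracts $\mathrm{outdeg}_G(v)$ from $c(v)$ and adds one chip to each out-neighbour $w\ne s$ of $v$ (chips sent to $s$ vanish). Legal firing = firing an active vertex; $c\to^*d$ means reachable by legal firings; $c$ is stable if no vertex is active; every configuration $c$ reaches by legal firings a unique stable configuration $c^\circ$. $c$ is accessible if for every configuration $d$ there is $d'$ with $d+d'\to^*c$; $c$ is recurrent if stable and accessible. For configurations, $c'\le c$ means componentwise. A recurrent $c$ is minimal if no recurrent $c'\neq c$ satisfies $c'\le c$. Let $\beta(v)=1$ if $(s,v)\in E$ and $\beta(v)=0$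 otherwise. It is known that if $c$ is recurrent then $(c+\beta)^\circ=c$ and any legal firing sequence from $c+\beta$ to $c$ fires each vertex of $V\setminus\{s\}$ exactly once. Firing graph: if $c$ is recurrent and $(w_1,\dots,w_k)$ is a legal firing sequence from $c+\beta$ ending at $c$, the corresponding firing graph of $c$ is the digraph with vertex set $V$ and arc set $\{(s,w_i):(s,w_i)\in E\}\cup\{(w_i,w_j): i<j,\ (w_i,w_j)\in E\}$. -}

module Defs where

open import Data.Nat using (ℕ; zero; suc; _+_; _∸_; _≤_; _≥_)
open import Data.Bool using (Bool; true; false; if_then_else_; _∧_)
open import Data.Fin using (Fin; _≟_)
open import Data.List using (List; []; _∷_; _++_; allFin; map)
open import Data.Nat.ListAction using (sum)
open import Data.List.Membership.Propositional using (_∈_)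
open import Data.Product using (Σ; ∃; _×_; _,_)
open import Data.Sum using (_⊎_)
open import Relation.Nullary using (¬_; yes; no)
open import Relation.Binary.PropositionalEquality using (_≡_; _≢_)
open import Relation.Binary.Construct.Closure.ReflexiveTransitive using (Star)
open import Function.Bundles using (_⇔_)

-- Digraphs: vertex set Fin n, arc set given by a Boolean relation
-- (so there are no multiple arcs).  E u v ≡ true  means (u,v) ∈ E.

ArcSet : ℕ → Set
ArcSet n = Fin n → Fin n → Bool

module _ {n : ℕ} where

  count : (Fin n → Bool) → ℕ
  count f = sum (map (λ w → if f w then 1 else 0) (allFin n))

  outdeg : ArcSet n → Fin n → ℕ
  outdeg E v = count (λ w → E v w)

  indeg : ArcSet n → Fin n → ℕ
  indeg E v = count (λ u → E u v)

  -- simple: no loops (no multiple arcs is automatic)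
  NoLoops : ArcSet n → Set
  NoLoops E = ∀ v → E v v ≡ false

  Eulerian : ArcSet n → Set
  Eulerian E = ∀ v → indeg E v ≡ outdeg E v

  Connected : ArcSet n → Set
  Connected E = ∀ u v → Star (λ a b → E a b ≡ true ⊎ E b a ≡ true) u v

  _⊆ₐ_ : ArcSet n → ArcSet n → Set
  A ⊆ₐ B = ∀ u v → A u v ≡ true → B u v ≡ true

  _≐_ : ArcSet n → ArcSet n → Set
  A ≐ B = ∀ u v → A u v ≡ B u v

  Acyclic : ArcSet n → Set
  Acyclic A = ∀ u v → A u v ≡ true → ¬ Star (λ a b → A a b ≡ true) v u

  addArc : ArcSet n → Fin n → Fin n → ArcSet n
  addArc A a b u v with u ≟ a | v ≟ b
  ... | yes _ | yes _ = true
  ... | _     | _     = A u v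

  MaximalAcyclic : ArcSet n → ArcSet n → Set
  MaximalAcyclic E A =
    A ⊆ₐ E × Acyclic A ×
    (∀ a b → E a b ≡ true → A a b ≡ false → ¬ Acyclic (addArc A a b))

  InAcal : ArcSet n → Fin n → ArcSet n → Set
  InAcal E s A =
    MaximalAcyclic E A × indeg A s ≡ 0 × (∀ v → v ≢ s → indeg A v ≢ 0)

-- A configuration is a map V → ℕ whose value at the sink s is ignored:
-- all notions below only look at vertices v ≢ s, and equality / order
-- of configurations are taken on V ∖ {s}.

Config : ℕ → Set
Config n = Fin n → ℕ

module Chip {n : ℕ} (E : ArcSet n) (s : Fin n) where

  _≈_ : Config n → Config n → Set
  c ≈ d = ∀ v → v ≢ s → c v ≡ d v

  _≤c_ : Config n → Config n → Set
  c ≤c d = ∀ v → v ≢ s → c v ≤ d v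

  _⊕_ : Config n → Config n → Config n
  (c ⊕ d) v = c v + d v

  Active : Config n → Fin n → Set
  Active c v = v ≢ s × outdeg E v ≥ 1 × c v ≥ outdeg E v

  fire : Config n → Fin n → Config n
  fire c v w with w ≟ v
  ... | yes _ = (c w ∸ outdeg E v) + (if E v w then 1 else 0)
  ... | no  _ = c w + (if E v w then 1 else 0)

  data Fires : Config n → List (Fin n) → Config n → Set where
    done : ∀ {c} → Fires c [] c
    step : ∀ {c v ws d} → Active c v → Fires (fire c v) ws d → Fires c (v ∷ ws) d

  FiresTo : Config n → List (Fin n) → Config n → Set
  FiresTo c ws d = Σ (Config n) λ d' → Fires c ws d' × d' ≈ d

  _→*_ : Config n → Config n → Set
  c →* d = ∃ λ ws → FiresTo c ws d

  Stable : Config n → Set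
  Stable c = ∀ v → ¬ Active c v

  Accessible : Config n → Set
  Accessible c = ∀ d → Σ (Config n) λ d' → (d ⊕ d') →* c

  Recurrent : Config n → Set
  Recurrent c = Stable c × Accessible c

  MinimalRecurrent : Config n → Set
  MinimalRecurrent c =
    Recurrent c × (∀ c' → Recurrent c' → c' ≤c c → c' ≈ c)

  β : Config n
  β v = if E s v then 1 else 0

  Before : List (Fin n) → Fin n → Fin n → Set
  Before ws a b = Σ (List (Fin n)) λ xs → Σ (List (Fin n)) λ ys →
                    ws ≡ xs ++ (a ∷ ys) × b ∈ ys

  FGArc : List (Fin n) → Fin n → Fin n → Set
  FGArc ws a b =
    (a ≡ s × b ∈ ws × E s b ≡ true) ⊎ (Before ws a b × E a b ≡ true)

  IsFiringGraph : Config n → ArcSet n → Set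
  IsFiringGraph c F =
    Σ (List (Fin n)) λ ws → FiresTo (c ⊕ β) ws c ×
      (∀ a b → (F a b ≡ true) ⇔ FGArc ws a b)

module Submission where

-- Everything is organised around legal orders: orderings L of the non-sink
-- vertices such that firing each once, in the order L, from c ⊕ β is legal.

open import Defs
open import Data.Bool using (Bool; true; false; if_then_else_; _∧_; _∨_; not)
open import Data.Bool.Properties using (∨-zeroʳ; ∨-identityʳ; ∧-zeroʳ; ∧-distribʳ-∨)
open import Data.Empty using (⊥; ⊥-elim)
open import Data.Fin using (Fin; zero; suc; _≟_)
open import Data.List using (List; []; _∷_; _++_; [_]; map; length; replicate; tabulate; allFin)
open import Data.List.Membership.Propositional using (_∈_; _∉_)
open import Data.List.Membership.Propositional.Properties using (∈-allFin; ∈-∃++; ∈-++⁻; ∈-++⁺ˡ; ∈-++⁺ʳ)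
open import Data.List.Properties using (map-tabulate; map-++; length-++; ++-assoc; ∷-injective)
open import Data.List.Relation.Unary.Any using (here; there)
open import Data.Nat using (ℕ; zero; suc; _+_; _*_; _∸_; _≤_; _<_; _≥_; z≤n; s≤s; s≤s⁻¹)
open import Data.Nat.ListAction using (sum)
open import Data.Nat.ListAction.Properties using (sum-++)
open import Data.Nat.Properties hiding (_≟_)
open import Algebra.Properties.CommutativeSemigroup +-commutativeSemigroup
  using (interchange; x∙yz≈y∙xz; x∙yz≈xz∙y; xy∙z≈xz∙y)
open import Data.Product using (Σ; _×_; _,_; proj₁; proj₂)
open import Data.Sum using (_⊎_; inj₁; inj₂)
open import Data.Unit using (⊤; tt)
open import Function using (_∘_)
open import Function.Bundles using (_⇔_; mk⇔; Equivalence)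
open import Relation.Binary.Construct.Closure.ReflexiveTransitive using (Star; ε; _◅_; _◅◅_)
open import Relation.Binary.PropositionalEquality
  using (_≡_; _≢_; refl; sym; trans; cong; cong₂; subst; module ≡-Reasoning)
open import Relation.Nullary using (¬_; yes; no; Dec)
open import Relation.Nullary.Decidable using (⌊_⌋)


ind : Bool → ℕ
ind b = if b then 1 else 0

true≢false : true ≢ false
true≢false ()

∨-true : ∀ {a b} → a ∨ b ≡ true → a ≡ true ⊎ b ≡ true
∨-true {true}  _ = inj₁ refl
∨-true {false} h = inj₂ h

∧-true : ∀ {a b} → a ∧ b ≡ true → a ≡ true × b ≡ true
∧-true {true} {true} _ = refl , refl

bool-ext : ∀ {a b} → (a ≡ true → b ≡ true) → (b ≡ true → a ≡ true) → a ≡ b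
bool-ext {true}  a⇒b _   = sym (a⇒b refl)
bool-ext {false} {true}  _ b⇒a = b⇒a refl
bool-ext {false} {false} _ _   = refl

eqb : ∀ {n} → Fin n → Fin n → Bool
eqb u x = ⌊ u ≟ x ⌋

eqb-refl : ∀ {n} (x : Fin n) → eqb x x ≡ true
eqb-refl x with x ≟ x
... | yes _  = refl
... | no x≢x = ⊥-elim (x≢x refl)

eqb-≢ : ∀ {n} {u x : Fin n} → u ≢ x → eqb u x ≡ false
eqb-≢ {u = u} {x} u≢x with u ≟ x
... | yes u≡x = ⊥-elim (u≢x u≡x)
... | no _    = refl

eqb-≡ : ∀ {n} {u x : Fin n} → eqb u x ≡ true → u ≡ x
eqb-≡ {u = u} {x} h with u ≟ x
... | yes u≡x = u≡x

-- Cardinality of a decidable subset of Fin n, by recursion on n: the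
-- recursive form of Defs.count, which is better suited to induction.
size : ∀ {n} → (Fin n → Bool) → ℕ
size {zero}  f = 0
size {suc n} f = ind (f zero) + size (f ∘ suc)

count≡size : ∀ {n} (f : Fin n → Bool) → count f ≡ size f
count≡size {zero}  f = refl
count≡size {suc n} f = cong (ind (f zero) +_) (begin
  sum (map (ind ∘ f) (tabulate suc))        ≡⟨ cong sum (map-tabulate suc (ind ∘ f)) ⟩
  sum (tabulate (ind ∘ f ∘ suc))            ≡⟨ cong sum (sym (map-tabulate (λ i → i) (ind ∘ f ∘ suc))) ⟩
  count (f ∘ suc)                           ≡⟨ count≡size (f ∘ suc) ⟩
  size (f ∘ suc)                            ∎)
  where open ≡-Reasoning

size-ext : ∀ {n} {f g : Fin n → Bool} → (∀ u → f u ≡ g u) → size f ≡ size g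
size-ext {zero}  _ = refl
size-ext {suc n} h = cong₂ _+_ (cong ind (h zero)) (size-ext (h ∘ suc))

size-∨ : ∀ {n} (f g : Fin n → Bool) →
  size (λ u → f u ∨ g u) + size (λ u → f u ∧ g u) ≡ size f + size g
size-∨ {zero}  f g = refl
size-∨ {suc n} f g = begin
  (ind (a ∨ b) + size (λ u → f (suc u) ∨ g (suc u))) + (ind (a ∧ b) + size (λ u → f (suc u) ∧ g (suc u)))
    ≡⟨ interchange (ind (a ∨ b)) _ (ind (a ∧ b)) _ ⟩
  (ind (a ∨ b) + ind (a ∧ b)) + (size (λ u → f (suc u) ∨ g (suc u)) + size (λ u → f (suc u) ∧ g (suc u)))
    ≡⟨ cong₂ _+_ (ind-∨ a b) (size-∨ (f ∘ suc) (g ∘ suc)) ⟩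
  (ind a + ind b) + (size (f ∘ suc) + size (g ∘ suc))
    ≡⟨ interchange (ind a) (ind b) _ _ ⟩
  (ind a + size (f ∘ suc)) + (ind b + size (g ∘ suc)) ∎
  where
  open ≡-Reasoning
  a b : Bool
  a = f zero
  b = g zero
  ind-∨ : ∀ a b → ind (a ∨ b) + ind (a ∧ b) ≡ ind a + ind b
  ind-∨ true  true  = refl
  ind-∨ true  false = refl
  ind-∨ false b     = +-identityʳ (ind b)

size-empty : ∀ {n} {f : Fin n → Bool} → (∀ u → f u ≡ false) → size f ≡ 0
size-empty {zero}      h = refl
size-empty {suc n} {f} h rewrite h zero = size-empty (h ∘ suc)

size-mono : ∀ {n} {f g : Fin n → Bool} → (∀ u → f u ≡ true → g u ≡ true) → size f ≤ size g
size-mono {zero}  h = z≤n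
size-mono {suc n} h = +-mono-≤ (ind-mono (h zero)) (size-mono (h ∘ suc))
  where
  ind-mono : ∀ {a b} → (a ≡ true → b ≡ true) → ind a ≤ ind b
  ind-mono {true}  h rewrite h refl = ≤-refl
  ind-mono {false} h = z≤n

size-≤ : ∀ {n} (f : Fin n → Bool) → size f ≤ n
size-≤ {zero}  f = z≤n
size-≤ {suc n} f = +-mono-≤ (ind≤1 (f zero)) (size-≤ (f ∘ suc))
  where
  ind≤1 : ∀ b → ind b ≤ 1
  ind≤1 true  = ≤-refl
  ind≤1 false = z≤n

size-pos : ∀ {n} {f : Fin n → Bool} u → f u ≡ true → 1 ≤ size f
size-pos {suc n} {f} zero    h rewrite h = s≤s z≤n
size-pos {suc n} {f} (suc u) h = ≤-trans (size-pos u h) (m≤n+m _ (ind (f zero)))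

size-witness : ∀ {n} (f : Fin n → Bool) → 1 ≤ size f → Σ (Fin n) λ u → f u ≡ true
size-witness {suc n} f h with f zero in eq
... | true  = zero , eq
... | false = let (u , p) = size-witness (f ∘ suc) h in suc u , p

size-empty⁻ : ∀ {n} (f : Fin n → Bool) → size f ≡ 0 → ∀ u → f u ≡ false
size-empty⁻ f h u with f u in eq
... | true  = ⊥-elim (<⇒≢ (size-pos u eq) (sym h))
... | false = refl

size-disjoint : ∀ {n} (f g : Fin n → Bool) → (∀ u → f u ∧ g u ≡ false) →
  size (λ u → f u ∨ g u) ≡ size f + size g
size-disjoint f g h = begin
  size (λ u → f u ∨ g u)                               ≡⟨ +-identityʳ _ ⟨
  size (λ u → f u ∨ g u) + 0                           ≡⟨ cong (size (λ u → f u ∨ g u) +_) (size-empty h) ⟨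
  size (λ u → f u ∨ g u) + size (λ u → f u ∧ g u)      ≡⟨ size-∨ f g ⟩
  size f + size g                                      ∎
  where open ≡-Reasoning

size-single : ∀ {n} (x : Fin n) (f : Fin n → Bool) → size (λ u → eqb u x ∧ f u) ≡ ind (f x)
size-single {suc n} zero    f =
  trans (cong (ind (f zero) +_) (size-empty {f = λ u → eqb (suc u) zero ∧ f (suc u)} (λ _ → refl)))
        (+-identityʳ _)
size-single {suc n} (suc x) f =
  trans (size-ext (λ u → cong (_∧ f (suc u)) (eqb-suc u)))
        (size-single x (f ∘ suc))
  where
  eqb-suc : ∀ u → eqb (suc u) (suc x) ≡ eqb u x
  eqb-suc u with u ≟ x
  ... | yes _ = refl
  ... | no _  = refl

size-strict : ∀ {n} (f g : Fin n → Bool) u → (∀ w → f w ≡ true → g w ≡ true) →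
  f u ≡ false → g u ≡ true → suc (size f) ≤ size g
size-strict f g u f⊆g fu gu = begin
  suc (size f)                       ≡⟨ +-comm 1 (size f) ⟩
  size f + 1                         ≡⟨ cong (size f +_) (size-single u (λ _ → true)) ⟨
  size f + size (λ w → eqb w u ∧ true) ≡⟨ size-disjoint f _ disjoint ⟨
  size (λ w → f w ∨ (eqb w u ∧ true)) ≤⟨ size-mono f+u⊆g ⟩
  size g                             ∎
  where
  open ≤-Reasoning
  disjoint : ∀ w → f w ∧ (eqb w u ∧ true) ≡ false
  disjoint w with w ≟ u
  ... | yes refl rewrite fu = refl
  ... | no _     = ∧-zeroʳ (f w)
  f+u⊆g : ∀ w → f w ∨ (eqb w u ∧ true) ≡ true → g w ≡ true
  f+u⊆g w h with f w in fw | w ≟ u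
  ... | true  | _        = f⊆g w fw
  ... | false | yes refl = gu

size-⊆-≥ : ∀ {n} {f g : Fin n → Bool} → (∀ w → f w ≡ true → g w ≡ true) →
  size g ≤ size f → ∀ u → g u ≡ true → f u ≡ true
size-⊆-≥ {f = f} {g} f⊆g g≤f u gu with f u in fu
... | true  = refl
... | false = ⊥-elim (<⇒≱ (size-strict f g u f⊆g fu gu) g≤f)

mem : ∀ {n} → List (Fin n) → Fin n → Bool
mem []      u = false
mem (x ∷ L) u = eqb u x ∨ mem L u

∈⇒mem : ∀ {n} {L : List (Fin n)} {u} → u ∈ L → mem L u ≡ true
∈⇒mem {L = x ∷ L} {u} (here refl) rewrite eqb-refl u = refl
∈⇒mem {L = x ∷ L} {u} (there u∈L) rewrite ∈⇒mem u∈L = ∨-zeroʳ (eqb u x)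

mem⇒∈ : ∀ {n} {L : List (Fin n)} {u} → mem L u ≡ true → u ∈ L
mem⇒∈ {L = x ∷ L} {u} h with u ≟ x
... | yes u≡x = here u≡x
... | no _    = there (mem⇒∈ h)

∉⇒mem : ∀ {n} {L : List (Fin n)} {u} → u ∉ L → mem L u ≡ false
∉⇒mem {L = L} {u} u∉L with mem L u in eq
... | true  = ⊥-elim (u∉L (mem⇒∈ eq))
... | false = refl

Distinct : ∀ {n} → List (Fin n) → Set
Distinct []      = ⊤
Distinct (x ∷ L) = x ∉ L × Distinct L

Distinct-++ˡ : ∀ {n} (P : List (Fin n)) {Q} → Distinct (P ++ Q) → Distinct P
Distinct-++ˡ []      _         = tt
Distinct-++ˡ (x ∷ P) (x∉ , dP) = (λ x∈P → x∉ (∈-++⁺ˡ x∈P)) , Distinct-++ˡ P dP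

Distinct-mid : ∀ {n} (P : List (Fin n)) {v Q} → Distinct (P ++ v ∷ Q) → v ∉ P
Distinct-mid (x ∷ P) (x∉ , _) (here refl) = x∉ (∈-++⁺ʳ P (here refl))
Distinct-mid (x ∷ P) (_ , dP) (there v∈P) = Distinct-mid P dP v∈P

Distinct-split : ∀ {n} {L : List (Fin n)} P P' {v} Q Q' → Distinct L →
  L ≡ P ++ v ∷ Q → L ≡ P' ++ v ∷ Q' → P ≡ P'
Distinct-split []      []       Q Q' _ _ _ = refl
Distinct-split []      (x ∷ P') {v} Q Q' (v∉ , _) refl e =
  ⊥-elim (v∉ (subst (v ∈_) (sym (proj₂ (∷-injective e))) (∈-++⁺ʳ P' (here refl))))
Distinct-split (x ∷ P) []       {v} Q Q' (x∉ , _) refl e =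
  ⊥-elim (x∉ (subst (_∈ P ++ v ∷ Q) (sym (proj₁ (∷-injective e))) (∈-++⁺ʳ P (here refl))))
Distinct-split (x ∷ P) (y ∷ P') Q Q' (_ , dL) refl e =
  let (x≡y , tails) = ∷-injective e in cong₂ _∷_ x≡y (Distinct-split P P' Q Q' dL refl tails)

∈-split : ∀ {n} {L : List (Fin n)} {P v Q} → L ≡ P ++ v ∷ Q → v ∈ L
∈-split {P = P} refl = ∈-++⁺ʳ P (here refl)

countIn : ∀ {n} → (Fin n → Bool) → List (Fin n) → ℕ
countIn f L = sum (map (ind ∘ f) L)

countIn-++ : ∀ {n} (f : Fin n → Bool) P Q → countIn f (P ++ Q) ≡ countIn f P + countIn f Q
countIn-++ f P Q = trans (cong sum (map-++ (ind ∘ f) P Q)) (sum-++ (map (ind ∘ f) P) _)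

size≤countIn : ∀ {n} (f : Fin n → Bool) L → size (λ u → mem L u ∧ f u) ≤ countIn f L
size≤countIn f [] = ≤-reflexive (size-empty {f = λ u → mem [] u ∧ f u} (λ _ → refl))
size≤countIn f (x ∷ L) = begin
  size (λ u → (eqb u x ∨ mem L u) ∧ f u)                 ≡⟨ size-ext (λ u → ∧-distribʳ-∨ (f u) (eqb u x) (mem L u)) ⟩
  size (λ u → (eqb u x ∧ f u) ∨ (mem L u ∧ f u))         ≤⟨ m≤m+n _ _ ⟩
  size (λ u → (eqb u x ∧ f u) ∨ (mem L u ∧ f u)) + _     ≡⟨ size-∨ (λ u → eqb u x ∧ f u) (λ u → mem L u ∧ f u) ⟩
  size (λ u → eqb u x ∧ f u) + size (λ u → mem L u ∧ f u) ≤⟨ +-mono-≤ (≤-reflexive (size-single x f)) (size≤countIn f L) ⟩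
  ind (f x) + countIn f L                                ∎
  where open ≤-Reasoning

-- Along a list without repetitions, counting entries is counting elements
-- (proved together with its one-step form size-cons).
countIn≡size : ∀ {n} (f : Fin n → Bool) L → Distinct L → countIn f L ≡ size (λ u → mem L u ∧ f u)

size-cons : ∀ {n} (f : Fin n → Bool) x P → Distinct P → x ∉ P →
  size (λ u → (eqb u x ∨ mem P u) ∧ f u) ≡ ind (f x) + countIn f P
size-cons f x P dP x∉P = begin
  size (λ u → (eqb u x ∨ mem P u) ∧ f u)                  ≡⟨ size-ext (λ u → ∧-distribʳ-∨ (f u) (eqb u x) (mem P u)) ⟩
  size (λ u → (eqb u x ∧ f u) ∨ (mem P u ∧ f u))          ≡⟨ size-disjoint _ _ disjoint ⟩
  size (λ u → eqb u x ∧ f u) + size (λ u → mem P u ∧ f u) ≡⟨ cong₂ _+_ (size-single x f) (sym (countIn≡size f P dP)) ⟩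
  ind (f x) + countIn f P                                 ∎
  where
  open ≡-Reasoning
  disjoint : ∀ u → (eqb u x ∧ f u) ∧ (mem P u ∧ f u) ≡ false
  disjoint u with u ≟ x
  ... | no _     = refl
  ... | yes refl rewrite ∉⇒mem x∉P = ∧-zeroʳ (f u)

countIn≡size f [] _ = sym (size-empty {f = λ u → mem [] u ∧ f u} (λ _ → refl))
countIn≡size f (x ∷ L) (x∉L , dL) = sym (size-cons f x L dL x∉L)

countIn-mono : ∀ {n} (f : Fin n → Bool) P Q → Distinct P →
  (∀ u → u ∈ P → f u ≡ true → u ∈ Q) → countIn f P ≤ countIn f Q
countIn-mono f P Q dP P⊆Q = begin
  countIn f P                   ≡⟨ countIn≡size f P dP ⟩
  size (λ u → mem P u ∧ f u)    ≤⟨ size-mono incl ⟩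
  size (λ u → mem Q u ∧ f u)    ≤⟨ size≤countIn f Q ⟩
  countIn f Q                   ∎
  where
  open ≤-Reasoning
  incl : ∀ u → mem P u ∧ f u ≡ true → mem Q u ∧ f u ≡ true
  incl u h with mem P u in uP | f u in fu
  incl u h | true | true rewrite ∈⇒mem (P⊆Q u (mem⇒∈ uP) fu) = refl

countIn-witness : ∀ {n} (f : Fin n → Bool) L → 1 ≤ countIn f L → Σ (Fin n) λ u → u ∈ L × f u ≡ true
countIn-witness f (x ∷ L) h with f x in fx
... | true  = x , here refl , fx
... | false = let (u , u∈L , fu) = countIn-witness f L h in u , there u∈L , fu

Distinct-length : ∀ {n} (L : List (Fin n)) → Distinct L → length L ≤ n
Distinct-length L dL = begin
  length L                            ≡⟨ length≡countIn L ⟩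
  countIn (λ _ → true) L              ≡⟨ countIn≡size (λ _ → true) L dL ⟩
  size (λ u → mem L u ∧ true)         ≤⟨ size-≤ _ ⟩
  _                                   ∎
  where
  open ≤-Reasoning
  length≡countIn : ∀ L → length L ≡ countIn (λ _ → true) L
  length≡countIn []      = refl
  length≡countIn (x ∷ L) = cong suc (length≡countIn L)

occ : ∀ {n} → Fin n → List (Fin n) → ℕ
occ w L = countIn (λ u → eqb u w) L

occ-++ : ∀ {n} (w : Fin n) P Q → occ w (P ++ Q) ≡ occ w P + occ w Q
occ-++ w = countIn-++ (λ u → eqb u w)

occ-mid : ∀ {n} (w v : Fin n) α₁ α₂ → occ w (α₁ ++ v ∷ α₂) ≡ ind (eqb v w) + occ w (α₁ ++ α₂)
occ-mid w v α₁ α₂ = begin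
  occ w (α₁ ++ v ∷ α₂)          ≡⟨ occ-++ w α₁ (v ∷ α₂) ⟩
  occ w α₁ + (i + occ w α₂)     ≡⟨ x∙yz≈y∙xz (occ w α₁) i _ ⟩
  i + (occ w α₁ + occ w α₂)     ≡⟨ cong (i +_) (occ-++ w α₁ α₂) ⟨
  i + occ w (α₁ ++ α₂)          ∎
  where
  open ≡-Reasoning
  i : ℕ
  i = ind (eqb v w)

occ-∈ : ∀ {n} {w : Fin n} {L} → w ∈ L → 1 ≤ occ w L
occ-∈ {w = w} (here refl) rewrite eqb-refl w = s≤s z≤n
occ-∈ {L = x ∷ L} (there w∈L) = ≤-trans (occ-∈ w∈L) (m≤n+m _ _)

occ-∈⁻ : ∀ {n} {w : Fin n} L → 1 ≤ occ w L → w ∈ L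
occ-∈⁻ L h = let (u , u∈L , u=w) = countIn-witness _ L h in subst (_∈ L) (eqb-≡ u=w) u∈L

occ-∉ : ∀ {n} {w : Fin n} L → w ∉ L → occ w L ≡ 0
occ-∉ {w = w} L w∉L with occ w L in eq
... | zero  = refl
... | suc _ = ⊥-elim (w∉L (occ-∈⁻ L (subst (1 ≤_) (sym eq) (s≤s z≤n))))

occ-Distinct : ∀ {n} {w : Fin n} L → Distinct L → occ w L ≤ 1
occ-Distinct []      _          = z≤n
occ-Distinct {w = w} (x ∷ L) (x∉L , dL) with x ≟ w
... | yes refl rewrite occ-∉ L x∉L = ≤-refl
... | no _     = occ-Distinct L dL

Distinct-occ : ∀ {n} (L : List (Fin n)) → (∀ w → occ w L ≤ 1) → Distinct L
Distinct-occ []      _ = tt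
Distinct-occ (x ∷ L) h =
  (λ x∈L → <⇒≱ (+-mono-≤ (≤-reflexive (cong ind (sym (eqb-refl x)))) (occ-∈ x∈L)) (h x))
  , Distinct-occ L (λ w → ≤-trans (m≤n+m _ _) (h w))

reach-along : ∀ {n} (R : Fin n → Fin n → Set) r L →
  (∀ P v Q → L ≡ P ++ v ∷ Q → Σ (Fin n) λ u → R u v × (u ≡ r ⊎ u ∈ P)) →
  ∀ v → v ∈ L → Star R r v
reach-along {n} R r L pred = go [] L refl (λ _ ())
  where
  go : ∀ P Q → L ≡ P ++ Q → (∀ u → u ∈ P → Star R r u) → ∀ v → v ∈ Q → Star R r v
  go P (w ∷ Q) L≡ reach-P = λ { v (here refl) → reach-w ; v (there v∈Q) → go (P ++ [ w ]) Q L≡' reach-Pw v v∈Q }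
    where
    via : (Σ (Fin n) λ u → R u w × (u ≡ r ⊎ u ∈ P)) → Star R r w
    via (u , u→w , inj₁ refl) = u→w ◅ ε
    via (u , u→w , inj₂ u∈P)  = reach-P u u∈P ◅◅ (u→w ◅ ε)
    reach-w : Star R r w
    reach-w = via (pred P w Q L≡)
    L≡' : L ≡ (P ++ [ w ]) ++ Q
    L≡' = trans L≡ (sym (++-assoc P [ w ] Q))
    reach-Pw : ∀ u → u ∈ P ++ [ w ] → Star R r u
    reach-Pw u u∈ with ∈-++⁻ P u∈
    ... | inj₁ u∈P         = reach-P u u∈P
    ... | inj₂ (here refl) = reach-w

gap-pos : ∀ {c d} t → c < d → d ≤ c + t → 1 ≤ t
gap-pos {c} zero    c<d d≤c = ⊥-elim (<⇒≱ c<d (subst (_ ≤_) (+-identityʳ c) d≤c))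
gap-pos     (suc t) _   _   = s≤s z≤n

surplus-∸1 : ∀ c t d → suc d ≤ c + t → d ≤ (c ∸ 1) + t
surplus-∸1 zero    t d d<t        = ≤-trans (n≤1+n d) d<t
surplus-∸1 (suc c) t d (s≤s d≤ct) = d≤ct

module Dynamics {n : ℕ} (E : ArcSet n) (s : Fin n) (loopless : NoLoops E) where
  open Chip E s public

  δ : Fin n → ℕ
  δ = outdeg E

  arcs : Fin n → Fin n → ℕ
  arcs u v = ind (E u v)

  -- chips received by v when the vertices of P fire once each
  inFrom : List (Fin n) → Fin n → ℕ
  inFrom P v = countIn (λ u → E u v) P

  arcs-self : ∀ v → arcs v v ≡ 0
  arcs-self v rewrite loopless v = refl

  fire-self : ∀ c v → fire c v v ≡ c v ∸ δ v
  fire-self c v with v ≟ v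
  ... | yes _    rewrite loopless v = +-identityʳ _
  ... | no v≢v   = ⊥-elim (v≢v refl)

  fire-other : ∀ c v w → w ≢ v → fire c v w ≡ c w + arcs v w
  fire-other c v w w≢v with w ≟ v
  ... | yes w≡v = ⊥-elim (w≢v w≡v)
  ... | no _    = refl

  ≈-refl : ∀ {c} → c ≈ c
  ≈-refl v _ = refl

  ≈-sym : ∀ {c d} → c ≈ d → d ≈ c
  ≈-sym h v v≢s = sym (h v v≢s)

  ≈-trans : ∀ {c d e} → c ≈ d → d ≈ e → c ≈ e
  ≈-trans h k v v≢s = trans (h v v≢s) (k v v≢s)

  fire-cong : ∀ {c d} v → c ≈ d → fire c v ≈ fire d v
  fire-cong v h w w≢s with w ≟ v
  ... | yes _ = cong (λ z → (z ∸ δ v) + arcs v w) (h w w≢s)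
  ... | no _  = cong (_+ arcs v w) (h w w≢s)

  Active-cong : ∀ {c d v} → c ≈ d → Active c v → Active d v
  Active-cong h (v≢s , δ≥1 , enough) = v≢s , δ≥1 , subst (_≥ _) (h _ v≢s) enough

  Stable-cong : ∀ {c d} → c ≈ d → Stable c → Stable d
  Stable-cong h st v act = st v (Active-cong (≈-sym h) act)

  Fires-cong : ∀ {x x' ws y} → Fires x ws y → x ≈ x' → Σ (Config n) λ y' → Fires x' ws y' × y ≈ y'
  Fires-cong done        h = _ , done , h
  Fires-cong (step a fs) h =
    let (y' , fs' , k) = Fires-cong fs (fire-cong _ h) in y' , step (Active-cong h a) fs' , k

  Fires-++ : ∀ {x z y P Q} → Fires x P z → Fires z Q y → Fires x (P ++ Q) y
  Fires-++ done        gs = gs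
  Fires-++ (step a fs) gs = step a (Fires-++ fs gs)

  Fires-split : ∀ {x y} P {Q} → Fires x (P ++ Q) y → Σ (Config n) λ z → Fires x P z × Fires z Q y
  Fires-split []      fs          = _ , done , fs
  Fires-split (v ∷ P) (step a fs) = let (z , fs₁ , fs₂) = Fires-split P fs in z , step a fs₁ , fs₂

  FiresTo-cong : ∀ {x x' ws y y'} → FiresTo x ws y → x ≈ x' → y ≈ y' → FiresTo x' ws y'
  FiresTo-cong (z , fs , z≈y) hx hy =
    let (z' , fs' , k) = Fires-cong fs hx in z' , fs' , ≈-trans (≈-sym k) (≈-trans z≈y hy)

  FiresTo-++ : ∀ {x z y P Q} → FiresTo x P z → FiresTo z Q y → FiresTo x (P ++ Q) y
  FiresTo-++ (z' , fs , z'≈z) gs =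
    let (y' , gs' , y'≈y) = FiresTo-cong gs (≈-sym z'≈z) ≈-refl in y' , Fires-++ fs gs' , y'≈y

  Fires-nonsink : ∀ {x ws y} → Fires x ws y → s ∉ ws
  Fires-nonsink (step (s≢s , _) _) (here refl) = s≢s refl
  Fires-nonsink (step _ fs)        (there s∈)  = Fires-nonsink fs s∈

  fire-⊕ : ∀ x z v → δ v ≤ x v → fire (x ⊕ z) v ≈ (fire x v ⊕ z)
  fire-⊕ x z v enough w _ with w ≟ v
  ... | yes refl = trans (cong (_+ arcs v v) (+-∸-comm (z v) enough)) (xy∙z≈xz∙y (x v ∸ δ v) (z v) _)
  ... | no _     = xy∙z≈xz∙y (x w) (z w) _

  Fires-⊕ : ∀ {x ws y} z → Fires x ws y → Σ (Config n) λ y' → Fires (x ⊕ z) ws y' × y' ≈ (y ⊕ z)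
  Fires-⊕ z done = _ , done , ≈-refl
  Fires-⊕ {x} z (step {v = v} (v≢s , δ≥1 , enough) fs) =
    let (y₁ , fs₁ , k₁) = Fires-⊕ z fs
        (y₂ , fs₂ , k₂) = Fires-cong fs₁ (≈-sym (fire-⊕ x z v enough))
    in y₂ , step (v≢s , δ≥1 , ≤-trans enough (m≤m+n _ _)) fs₂ , ≈-trans (≈-sym k₂) k₁

  FiresTo-⊕ : ∀ {x ws y} z → FiresTo x ws y → FiresTo (x ⊕ z) ws (y ⊕ z)
  FiresTo-⊕ z (y' , fs , y'≈y) =
    let (y₂ , fs₂ , k) = Fires-⊕ z fs in y₂ , fs₂ , ≈-trans k (λ v v≢s → cong (_+ z v) (y'≈y v v≢s))

  fire-balance : ∀ x v w → δ v ≤ x v → fire x v w + δ w * ind (eqb v w) ≡ x w + arcs v w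
  fire-balance x v w enough with v ≟ w
  ... | yes refl = begin
    fire x v v + δ v * 1        ≡⟨ cong₂ _+_ (fire-self x v) (*-identityʳ (δ v)) ⟩
    (x v ∸ δ v) + δ v           ≡⟨ m∸n+n≡m enough ⟩
    x v                         ≡⟨ +-identityʳ _ ⟨
    x v + 0                     ≡⟨ cong (x v +_) (arcs-self v) ⟨
    x v + arcs v v              ∎
    where open ≡-Reasoning
  ... | no v≢w = trans (cong₂ _+_ (fire-other x v w (λ w≡v → v≢w (sym w≡v))) (*-zeroʳ (δ w)))
                       (+-identityʳ _)

  conservation : ∀ {x ws y} → Fires x ws y → ∀ w → y w + δ w * occ w ws ≡ x w + inFrom ws w
  conservation {x} done w = cong (x w +_) (*-zeroʳ (δ w))
  conservation {x} {v ∷ ws} {y} (step (_ , _ , enough) fs) w = begin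
    y w + δ w * (i + occ w ws)                ≡⟨ cong (y w +_) (*-distribˡ-+ (δ w) i _) ⟩
    y w + (δ w * i + δ w * occ w ws)          ≡⟨ x∙yz≈xz∙y (y w) _ _ ⟩
    (y w + δ w * occ w ws) + δ w * i          ≡⟨ cong (_+ δ w * i) (conservation fs w) ⟩
    (fire x v w + inFrom ws w) + δ w * i      ≡⟨ xy∙z≈xz∙y (fire x v w) _ _ ⟩
    (fire x v w + δ w * i) + inFrom ws w      ≡⟨ cong (_+ inFrom ws w) (fire-balance x v w enough) ⟩
    (x w + arcs v w) + inFrom ws w            ≡⟨ +-assoc (x w) _ _ ⟩
    x w + (arcs v w + inFrom ws w)            ∎
    where
    open ≡-Reasoning
    i : ℕ
    i = ind (eqb v w)

  Active-fire : ∀ {x v w} → w ≢ v → Active x v → Active (fire x w) v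
  Active-fire {x} {v} {w} w≢v (v≢s , δ≥1 , enough) =
    v≢s , δ≥1 , ≤-trans enough (≤-trans (m≤m+n _ _)
                                   (≤-reflexive (sym (fire-other x w v (λ v≡w → w≢v (sym v≡w))))))

  fire-commute : ∀ x v w → v ≢ w → δ v ≤ x v → δ w ≤ x w →
    ∀ u → fire (fire x v) w u ≡ fire (fire x w) v u
  fire-commute x v w v≢w enough-v enough-w u = by-cases (u ≟ v) (u ≟ w)
    where
    open ≡-Reasoning
    by-cases : Dec (u ≡ v) → Dec (u ≡ w) → fire (fire x v) w u ≡ fire (fire x w) v u
    by-cases (yes refl) (yes refl) = ⊥-elim (v≢w refl)
    by-cases (yes refl) (no u≢w) = begin
      fire (fire x u) w u     ≡⟨ fire-other (fire x u) w u u≢w ⟩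
      fire x u u + arcs w u   ≡⟨ cong (_+ arcs w u) (fire-self x u) ⟩
      (x u ∸ δ u) + arcs w u  ≡⟨ +-∸-comm (arcs w u) enough-v ⟨
      (x u + arcs w u) ∸ δ u  ≡⟨ cong (_∸ δ u) (fire-other x w u u≢w) ⟨
      fire x w u ∸ δ u        ≡⟨ fire-self (fire x w) u ⟨
      fire (fire x w) u u     ∎
    by-cases (no u≢v) (yes refl) = begin
      fire (fire x v) u u     ≡⟨ fire-self (fire x v) u ⟩
      fire x v u ∸ δ u        ≡⟨ cong (_∸ δ u) (fire-other x v u u≢v) ⟩
      (x u + arcs v u) ∸ δ u  ≡⟨ +-∸-comm (arcs v u) enough-w ⟩
      (x u ∸ δ u) + arcs v u  ≡⟨ cong (_+ arcs v u) (fire-self x u) ⟨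
      fire x u u + arcs v u   ≡⟨ fire-other (fire x u) v u u≢v ⟨
      fire (fire x u) v u     ∎
    by-cases (no u≢v) (no u≢w) = begin
      fire (fire x v) w u         ≡⟨ fire-other (fire x v) w u u≢w ⟩
      fire x v u + arcs w u       ≡⟨ cong (_+ arcs w u) (fire-other x v u u≢v) ⟩
      (x u + arcs v u) + arcs w u ≡⟨ xy∙z≈xz∙y (x u) _ _ ⟩
      (x u + arcs w u) + arcs v u ≡⟨ cong (_+ arcs v u) (fire-other x w u u≢w) ⟨
      fire x w u + arcs v u       ≡⟨ fire-other (fire x w) v u u≢v ⟨
      fire (fire x w) v u         ∎

  exchange : ∀ {x α y v} → Fires x α y → Stable y → Active x v →
    Σ (List (Fin n)) λ α₁ → Σ (List (Fin n)) λ α₂ →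
      α ≡ α₁ ++ v ∷ α₂ × FiresTo (fire x v) (α₁ ++ α₂) y
  exchange done st act = ⊥-elim (st _ act)
  exchange {x} {v = v} (step {v = w} act-w fs) st act-v with w ≟ v
  ... | yes refl = [] , _ , refl , _ , fs , ≈-refl
  ... | no w≢v =
    let (α₁ , α₂ , α≡ , ft) = exchange fs st (Active-fire w≢v act-v)
        swap = λ u _ → sym (fire-commute x v w (λ v≡w → w≢v (sym v≡w))
                                          (proj₂ (proj₂ act-v)) (proj₂ (proj₂ act-w)) u)
        (y' , fs' , y'≈y) = FiresTo-cong ft swap ≈-refl
    in w ∷ α₁ , α₂ , cong (w ∷_) α≡ ,
       y' , step (Active-fire (λ v≡w → w≢v (sym v≡w)) act-w) fs' , y'≈y

  least-action : ∀ {x α y γ z} → Fires x α y → Stable y → Fires x γ z →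
    Σ (List (Fin n)) λ α' → FiresTo z α' y × (∀ w → occ w α ≡ occ w γ + occ w α')
  least-action {α = α} fs st done = α , (_ , fs , ≈-refl) , (λ w → refl)
  least-action fs st (step {v = v} {ws = γ} act gs) =
    let (α₁ , α₂ , α≡ , (y₁ , fs₁ , y₁≈y)) = exchange fs st act
        (α' , ft , counts) = least-action fs₁ (Stable-cong (≈-sym y₁≈y) st) gs
        i = λ w → ind (eqb v w)
    in α' , FiresTo-cong ft ≈-refl y₁≈y ,
       λ w → trans (cong (occ w) α≡) (trans (occ-mid w v α₁ α₂)
               (trans (cong (i w +_) (counts w)) (sym (+-assoc (i w) (occ w γ) (occ w α')))))

  same-firings : ∀ {x α y γ z} → Fires x α y → Stable y → Fires x γ z → z ≈ y →
    ∀ w → occ w α ≡ occ w γ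
  same-firings fs st gs z≈y w with least-action fs st gs
  ... | []      , _ , counts                 = trans (counts w) (+-identityʳ _)
  ... | (v ∷ _) , (_ , step act _ , _) , _  = ⊥-elim (st v (Active-cong z≈y act))

module Orders {n : ℕ} (E : ArcSet n) (s : Fin n)
              (loopless : NoLoops E) (eulerian : Eulerian E) (connected : Connected E) where
  open Dynamics E s loopless public

  δ≡size-in : ∀ v → δ v ≡ size (λ u → E u v)
  δ≡size-in v = trans (sym (eulerian v)) (count≡size (λ u → E u v))

  δ-pos : ∀ v → v ≢ s → 1 ≤ δ v
  δ-pos v v≢s with connected v s
  ... | ε                = ⊥-elim (v≢s refl)
  ... | inj₁ v→w ◅ _     = subst (1 ≤_) (sym (count≡size (E v))) (size-pos {f = E v} _ v→w)
  ... | inj₂ w→v ◅ _     = subst (1 ≤_) (sym (δ≡size-in v)) (size-pos {f = λ u → E u v} _ w→v)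

  stable-below : ∀ {c v} → Stable c → v ≢ s → c v < δ v
  stable-below {c} {v} st v≢s = ≰⇒> (λ δ≤c → st v (v≢s , δ-pos v v≢s , δ≤c))

  Complete : List (Fin n) → Set
  Complete L = Distinct L × s ∉ L × (∀ v → v ≢ s → v ∈ L)

  Complete-≢ : ∀ {L v} → Complete L → v ∈ L → v ≢ s
  Complete-≢ (_ , s∉L , _) v∈L refl = s∉L v∈L

  entry-≢ : ∀ {L P v Q} → Complete L → L ≡ P ++ v ∷ Q → v ≢ s
  entry-≢ cL L≡ = Complete-≢ cL (∈-split L≡)

  received : List (Fin n) → Fin n → ℕ
  received P v = β v + inFrom P v

  feeds : List (Fin n) → Fin n → Fin n → Bool
  feeds P v u = (eqb u s ∨ mem P u) ∧ E u v

  received≡size : ∀ P v → Distinct P → s ∉ P → size (feeds P v) ≡ received P v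
  received≡size P v dP s∉P = size-cons (λ u → E u v) s P dP s∉P

  feeds-size : ∀ {W P v Q} → Complete W → W ≡ P ++ v ∷ Q → size (feeds P v) ≡ received P v
  feeds-size {P = P} {v} (dW , s∉W , _) W≡ =
    received≡size P v (Distinct-++ˡ P (subst Distinct W≡ dW)) (λ s∈P → s∉W (subst (s ∈_) (sym W≡) (∈-++⁺ˡ s∈P)))

  received-all : ∀ L → Complete L → ∀ v → received L v ≡ δ v
  received-all L (dL , s∉L , cover) v = begin
    received L v                                 ≡⟨ received≡size L v dL s∉L ⟨
    size (feeds L v)                             ≡⟨ size-ext everything ⟩
    size (λ u → E u v)                           ≡⟨ δ≡size-in v ⟨
    δ v                                          ∎
    where
    open ≡-Reasoning
    everything : ∀ u → feeds L v u ≡ E u v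
    everything u with u ≟ s
    ... | yes _   = refl
    ... | no u≢s  rewrite ∈⇒mem (cover u u≢s) = refl

  received-split : ∀ L P v Q → Complete L → L ≡ P ++ v ∷ Q → received P v + inFrom Q v ≡ δ v
  received-split L P v Q cL refl = begin
    (β v + inFrom P v) + inFrom Q v          ≡⟨ +-assoc (β v) _ _ ⟩
    β v + (inFrom P v + inFrom Q v)          ≡⟨ cong (λ k → β v + (inFrom P v + (k + inFrom Q v))) (arcs-self v) ⟨
    β v + (inFrom P v + inFrom (v ∷ Q) v)    ≡⟨ cong (β v +_) (countIn-++ (λ u → E u v) P (v ∷ Q)) ⟨
    received L v                             ≡⟨ received-all L cL v ⟩
    δ v                                      ∎
    where open ≡-Reasoning

  Legal : Config n → List (Fin n) → Set
  Legal c L = ∀ P v Q → L ≡ P ++ v ∷ Q → δ v ≤ c v + received P v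

  fire-along : ∀ L x → Distinct L →
    (∀ P v Q → L ≡ P ++ v ∷ Q → v ≢ s × δ v ≤ x v + inFrom P v) →
    Σ (Config n) λ y → Fires x L y
  fire-along []      x _          _      = x , done
  fire-along (v ∷ L) x (v∉L , dL) enough =
    let (v≢s , δ≤) = enough [] v L refl
        (y , fs)   = fire-along L (fire x v) dL later
    in y , step (v≢s , δ-pos v v≢s , subst (δ v ≤_) (+-identityʳ (x v)) δ≤) fs
    where
    later : ∀ P w Q → L ≡ P ++ w ∷ Q → w ≢ s × δ w ≤ fire x v w + inFrom P w
    later P w Q L≡ =
      let (w≢s , δ≤) = enough (v ∷ P) w Q (cong (v ∷_) L≡)
          w≢v : w ≢ v
          w≢v = λ { refl → v∉L (∈-split L≡) }
      in w≢s , subst (δ w ≤_) (trans (sym (+-assoc (x w) _ _))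
                                     (cong (_+ inFrom P w) (sym (fire-other x v w w≢v)))) δ≤

  -- A legal order fires c ⊕ β back to c: each vertex fires once, so it
  -- loses δ v chips and receives δ v chips.
  legal-fires : ∀ c L → Complete L → Legal c L → FiresTo (c ⊕ β) L c
  legal-fires c L cL@(dL , s∉L , cover) legal =
    let (y , fs) = fire-along L (c ⊕ β) dL (λ P v Q L≡ →
                     entry-≢ cL L≡ ,
                     subst (δ v ≤_) (sym (+-assoc (c v) _ _)) (legal P v Q L≡))
    in y , fs , λ w w≢s → +-cancelʳ-≡ (δ w) (y w) (c w) (balance y fs w w≢s)
    where
    balance : ∀ y → Fires (c ⊕ β) L y → ∀ w → w ≢ s → y w + δ w ≡ c w + δ w
    balance y fs w w≢s = begin
      y w + δ w                       ≡⟨ cong (y w +_) (*-identityʳ (δ w)) ⟨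
      y w + δ w * 1                   ≡⟨ cong (λ k → y w + δ w * k) once ⟨
      y w + δ w * occ w L             ≡⟨ conservation fs w ⟩
      (c w + β w) + inFrom L w        ≡⟨ +-assoc (c w) _ _ ⟩
      c w + received L w              ≡⟨ cong (c w +_) (received-all L cL w) ⟩
      c w + δ w                       ∎
      where
      open ≡-Reasoning
      once : occ w L ≡ 1
      once = ≤-antisym (occ-Distinct L dL) (occ-∈ (cover w w≢s))

  first-firing : ∀ {x L y} → Fires x L y → ∀ P v Q → L ≡ P ++ v ∷ Q → v ∉ P → δ v ≤ x v + inFrom P v
  first-firing {x} fs P v Q refl v∉P =
    let (z , fs₁ , fs₂) = Fires-split P fs
        z≡ : z v ≡ x v + inFrom P v
        z≡ = begin
          z v                    ≡⟨ +-identityʳ (z v) ⟨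
          z v + 0                ≡⟨ cong (z v +_) (*-zeroʳ (δ v)) ⟨
          z v + δ v * 0          ≡⟨ cong (λ k → z v + δ v * k) (occ-∉ P v∉P) ⟨
          z v + δ v * occ v P    ≡⟨ conservation fs₁ v ⟩
          x v + inFrom P v       ∎
    in subst (δ v ≤_) z≡ (enough-first fs₂)
    where
    open ≡-Reasoning
    enough-first : ∀ {z Q y} → Fires z (v ∷ Q) y → δ v ≤ z v
    enough-first (step (_ , _ , enough) _) = enough

  Kβ : ℕ → Config n
  Kβ K v = K * β v

  Loadable : Fin n → Set
  Loadable v = ∀ N → Σ ℕ λ K → Σ (List (Fin n)) λ σ → Σ (Config n) λ y →
                 FiresTo (Kβ K) σ y × N ≤ y v

  loadable-root : ∀ {v} → E s v ≡ true → Loadable v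
  loadable-root {v} s→v N =
    N , [] , Kβ N , (Kβ N , done , ≈-refl) ,
    ≤-reflexive (sym (trans (cong (λ b → N * ind b) s→v) (*-identityʳ N)))

  fire-repeatedly : ∀ N y u → u ≢ s → 1 ≤ δ u → N * δ u ≤ y u →
    Σ (Config n) λ y' → Fires y (replicate N u) y' × (∀ w → w ≢ u → y' w ≡ y w + N * arcs u w)
  fire-repeatedly zero    y u _   _   _ = y , done , λ w _ → sym (+-identityʳ (y w))
  fire-repeatedly (suc N) y u u≢s δ≥1 enough =
    let enough' : N * δ u ≤ fire y u u
        enough' = subst (N * δ u ≤_) (sym (fire-self y u))
                    (subst (_≤ y u ∸ δ u) (m+n∸m≡n (δ u) (N * δ u)) (∸-monoˡ-≤ (δ u) enough))
        (y' , fs , y'≡) = fire-repeatedly N (fire y u) u u≢s δ≥1 enough'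
    in y' , step (u≢s , δ≥1 , ≤-trans (m≤m+n (δ u) (N * δ u)) enough) fs ,
       λ w w≢u → trans (y'≡ w w≢u) (trans (cong (_+ N * arcs u w) (fire-other y u w w≢u))
                                          (+-assoc (y w) (arcs u w) (N * arcs u w)))

  -- Loading u with N · δ u chips and firing it N times loads its out-neighbours.
  loadable-step : ∀ {u v} → Loadable u → u ≢ s → E u v ≡ true → Loadable v
  loadable-step {u} {v} load-u u≢s u→v N =
    let (K , σ , y , (y₀ , fs₀ , y₀≈y) , enough) = load-u (N * δ u)
        (y' , fs₁ , y'≡) = fire-repeatedly N y₀ u u≢s (subst (1 ≤_) (sym (count≡size (E u))) (size-pos {f = E u} v u→v))
                             (subst (N * δ u ≤_) (sym (y₀≈y u u≢s)) enough)
        v≢u : v ≢ u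
        v≢u = λ { refl → true≢false (trans (sym u→v) (loopless v)) }
    in K , σ ++ replicate N u , y' , (y' , Fires-++ fs₀ fs₁ , ≈-refl) ,
       subst (N ≤_) (sym (y'≡ v v≢u))
         (≤-trans (≤-reflexive (sym (trans (cong (λ b → N * ind b) u→v) (*-identityʳ N))))
                  (m≤n+m (N * arcs u v) (y₀ v)))

  loadable-path : ∀ {a v} → Star (λ a b → E a b ≡ true) a v → (a ≡ s ⊎ (a ≢ s × Loadable a)) →
    v ≢ s → Loadable v
  loadable-path ε (inj₁ refl)        v≢s = ⊥-elim (v≢s refl)
  loadable-path ε (inj₂ (_ , load))  _   = load
  loadable-path {a} (_◅_ {j = b} a→b path) a-ok v≢s with b ≟ s
  ... | yes b≡s = loadable-path path (inj₁ b≡s) v≢s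
  ... | no  b≢s = loadable-path path (inj₂ (b≢s , load-b a-ok)) v≢s
    where
    load-b : (a ≡ s ⊎ (a ≢ s × Loadable a)) → Loadable b
    load-b (inj₁ refl)            = loadable-root a→b
    load-b (inj₂ (a≢s , load-a)) = loadable-step load-a a≢s a→b

  load-all : (∀ v → v ≢ s → Star (λ a b → E a b ≡ true) s v) → (d : Config n) → ∀ L →
    Σ ℕ λ K → Σ (List (Fin n)) λ σ → Σ (Config n) λ y →
      FiresTo (Kβ K) σ y × (∀ v → v ∈ L → v ≢ s → d v ≤ y v)
  load-all paths d [] = 0 , [] , Kβ 0 , (Kβ 0 , done , ≈-refl) , λ v ()
  load-all paths d (v ∷ L) with v ≟ s | load-all paths d L
  ... | yes refl | (K , σ , y , ft , dom) =
    K , σ , y , ft , λ { w (here refl) w≢s → ⊥-elim (w≢s refl) ; w (there w∈L) w≢s → dom w w∈L w≢s }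
  ... | no v≢s   | (K₀ , σ₀ , y₀ , ft₀ , dom₀) =
    let (K₁ , σ₁ , y₁ , ft₁ , dom₁) = loadable-path (paths v v≢s) (inj₁ refl) v≢s (d v)
        first  = FiresTo-⊕ (Kβ K₁) ft₀
        second = FiresTo-cong (FiresTo-⊕ y₀ ft₁) (λ w _ → +-comm (Kβ K₁ w) (y₀ w)) ≈-refl
        both   = FiresTo-cong (FiresTo-++ first second) (λ w _ → sym (*-distribʳ-+ (β w) K₀ K₁)) ≈-refl
    in K₀ + K₁ , σ₀ ++ σ₁ , (y₁ ⊕ y₀) , both ,
       λ { w (here refl) _ → ≤-trans dom₁ (m≤m+n (y₁ w) (y₀ w))
         ; w (there w∈L) w≢s → ≤-trans (dom₀ w w∈L w≢s) (m≤n+m (y₀ w) (y₁ w)) }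

  repeat-burning : ∀ c W → FiresTo (c ⊕ β) W c → ∀ K → Σ (List (Fin n)) λ α → FiresTo (c ⊕ Kβ K) α c
  repeat-burning c W burn zero = [] , (c ⊕ Kβ 0 , done , λ v _ → +-identityʳ (c v))
  repeat-burning c W burn (suc K) =
    let (α , ft) = repeat-burning c W burn K
        once = FiresTo-cong (FiresTo-⊕ (Kβ K) burn) (λ v _ → +-assoc (c v) (β v) (K * β v)) ≈-refl
    in W ++ α , FiresTo-++ once ft

  -- A stable configuration with a burning sequence is accessible: from any
  -- d, add chips to reach c ⊕ y with y loaded from K β, and use least action
  -- to finish the repeated burning sequence from there.
  accessible : ∀ c W → Stable c → FiresTo (c ⊕ β) W c →
    (∀ v → v ≢ s → Star (λ a b → E a b ≡ true) s v) → Accessible c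
  accessible c W st burn paths d =
    let (K , σ , y , ft , dom) = load-all paths d (allFin n)
        (α , (y₁ , fs₁ , y₁≈c)) = repeat-burning c W burn K
        (z , fs₂ , z≈) = FiresTo-⊕ c ft
        (z' , fs₂' , z'≈) = Fires-cong fs₂ (λ v _ → +-comm (Kβ K v) (c v))
        (α' , rest , _) = least-action fs₁ (Stable-cong (≈-sym y₁≈c) st) fs₂'
        d' : Config n
        d' v = (c v + y v) ∸ d v
        start : z' ≈ (d ⊕ d')
        start v v≢s = begin
          z' v               ≡⟨ z'≈ v v≢s ⟨
          z v                ≡⟨ z≈ v v≢s ⟩
          y v + c v          ≡⟨ +-comm (y v) (c v) ⟩
          c v + y v          ≡⟨ m+[n∸m]≡n (≤-trans (dom v (∈-allFin v) v≢s) (m≤n+m (y v) (c v))) ⟨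
          d v + d' v         ∎
    in d' , α' , FiresTo-cong rest start y₁≈c
    where open ≡-Reasoning

  -- Legality gives every
  -- vertex an in-neighbour that is s or earlier in the order, so s reaches
  -- every vertex and accessibility applies.
  legal-recurrent : ∀ c L → Stable c → Complete L → Legal c L → Recurrent c × FiresTo (c ⊕ β) L c
  legal-recurrent c L st cL legal = (st , accessible c L st burn paths) , burn
    where
    burn : FiresTo (c ⊕ β) L c
    burn = legal-fires c L cL legal
    pred : ∀ P v Q → L ≡ P ++ v ∷ Q → Σ (Fin n) λ u → E u v ≡ true × (u ≡ s ⊎ u ∈ P)
    pred P v Q L≡ with E s v in s→v
    ... | true  = s , s→v , inj₁ refl
    ... | false =
      let v≢s  = entry-≢ cL L≡
          some = gap-pos (received P v) (stable-below st v≢s) (legal P v Q L≡)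
          some' : 1 ≤ inFrom P v
          some' = subst (λ b → 1 ≤ ind b + inFrom P v) s→v some
          (u , u∈P , u→v) = countIn-witness (λ u → E u v) P some'
      in u , u→v , inj₂ u∈P
    paths : ∀ v → v ≢ s → Star (λ a b → E a b ≡ true) s v
    paths v v≢s = reach-along _ s L pred v (proj₂ (proj₂ cL) v v≢s)

  -- Every recurrent configuration has a legal order.  Fire δ ⊕ d' to c
  -- (accessibility) and list the vertices by their last firing: each then
  -- keeps every chip received after its last firing.
  RetainsLater : Config n → List (Fin n) → Set
  RetainsLater y []      = ⊤
  RetainsLater y (v ∷ Q) = inFrom Q v ≤ y v × RetainsLater y Q

  retains-split : ∀ {y} P {v Q} → RetainsLater y (P ++ v ∷ Q) → inFrom Q v ≤ y v
  retains-split []      (keeps , _) = keeps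
  retains-split (x ∷ P) (_ , rest)  = retains-split P rest

  unfired : ∀ {x ws y} → Fires x ws y → ∀ v → v ∉ ws → y v ≡ x v + inFrom ws v
  unfired {ws = ws} {y} fs v v∉ws = begin
    y v                  ≡⟨ +-identityʳ (y v) ⟨
    y v + 0              ≡⟨ cong (y v +_) (*-zeroʳ (δ v)) ⟨
    y v + δ v * 0        ≡⟨ cong (λ k → y v + δ v * k) (occ-∉ ws v∉ws) ⟨
    y v + δ v * occ v ws ≡⟨ conservation fs v ⟩
    _                    ∎
    where open ≡-Reasoning

  last-firing-order : ∀ {x ws y} → Fires x ws y → Σ (List (Fin n)) λ L →
    Distinct L × (∀ u → u ∈ L → u ∈ ws) × (∀ u → u ∈ ws → u ∈ L) × RetainsLater y L
  last-firing-order done = [] , tt , (λ _ ()) , (λ _ ()) , tt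
  last-firing-order {x} {v ∷ ws} {y} (step _ fs) with last-firing-order fs | mem ws v in v?ws
  ... | (L , dL , L⊆ , ⊆L , keeps) | true =
    L , dL , (λ u u∈L → there (L⊆ u u∈L)) ,
    (λ { u (here refl) → ⊆L u (mem⇒∈ v?ws) ; u (there u∈ws) → ⊆L u u∈ws }) , keeps
  ... | (L , dL , L⊆ , ⊆L , keeps) | false =
    v ∷ L , ((λ v∈L → v∉ws (L⊆ v v∈L)) , dL) ,
    (λ { u (here refl) → here refl ; u (there u∈L) → there (L⊆ u u∈L) }) ,
    (λ { u (here refl) → here refl ; u (there u∈ws) → there (⊆L u u∈ws) }) ,
    (keeps-v , keeps)
    where
    v∉ws : v ∉ ws
    v∉ws v∈ws with trans (sym (∈⇒mem v∈ws)) v?ws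
    ... | ()
    keeps-v : inFrom L v ≤ y v
    keeps-v = ≤-trans (countIn-mono (λ u → E u v) L ws dL (λ u u∈L _ → L⊆ u u∈L))
                      (subst (inFrom ws v ≤_) (sym (unfired fs v v∉ws)) (m≤n+m _ _))

  all-fire : ∀ {d' ws y} c → Stable c → Fires (δ ⊕ d') ws y → y ≈ c → ∀ v → v ≢ s → v ∈ ws
  all-fire {d'} {ws} {y} c st fs y≈c v v≢s with mem ws v in v?ws
  ... | true  = mem⇒∈ v?ws
  ... | false = ⊥-elim (st v (v≢s , δ-pos v v≢s , subst (δ v ≤_) (trans (sym (unfired fs v v∉ws)) (y≈c v v≢s))
                                                      (≤-trans (m≤m+n (δ v) (d' v)) (m≤m+n _ _))))
    where
    v∉ws : v ∉ ws
    v∉ws v∈ws with trans (sym (∈⇒mem v∈ws)) v?ws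
    ... | ()

  retains-legal : ∀ c y L → Complete L → RetainsLater y L → y ≈ c → Legal c L
  retains-legal c y L cL keeps y≈c P v Q L≡ = begin
    δ v                          ≡⟨ received-split L P v Q cL L≡ ⟨
    received P v + inFrom Q v    ≤⟨ +-monoʳ-≤ (received P v) kept ⟩
    received P v + c v           ≡⟨ +-comm _ (c v) ⟩
    c v + received P v           ∎
    where
    open ≤-Reasoning
    kept : inFrom Q v ≤ c v
    kept = subst (inFrom Q v ≤_) (y≈c v (entry-≢ cL L≡))
                 (retains-split P (subst (RetainsLater y) L≡ keeps))

  recurrent-legal-order : ∀ c → Recurrent c → Σ (List (Fin n)) λ L → Complete L × Legal c L
  recurrent-legal-order c (st , acc) =
    let (d' , ws , (y , fs , y≈c)) = acc δ
        (L , dL , L⊆ , ⊆L , keeps) = last-firing-order fs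
        cL : Complete L
        cL = dL , (λ s∈L → Fires-nonsink fs (L⊆ s s∈L)) , (λ v v≢s → ⊆L v (all-fire c st fs y≈c v v≢s))
    in L , cL , retains-legal c y L cL keeps y≈c

  -- Every firing sequence from c ⊕ β back to a recurrent c is a legal order:
  -- by the abelian property it fires each vertex as often as a legal order.
  burning-legal : ∀ c → Recurrent c → ∀ {ws} → FiresTo (c ⊕ β) ws c → Complete ws × Legal c ws
  burning-legal c rec {ws} (z , gs , z≈c) =
    let (L , cL@(dL , _ , coverL) , legalL) = recurrent-legal-order c rec
        (y , fs , y≈c) = legal-fires c L cL legalL
        same = same-firings fs (Stable-cong (≈-sym y≈c) (proj₁ rec)) gs (≈-trans z≈c (≈-sym y≈c))
        dws : Distinct ws
        dws = Distinct-occ ws (λ w → subst (_≤ 1) (same w) (occ-Distinct L dL))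
    in (dws , Fires-nonsink gs , λ v v≢s → occ-∈⁻ ws (subst (1 ≤_) (same v) (occ-∈ (coverL v v≢s)))) ,
       λ P v Q ws≡ → subst (δ v ≤_) (+-assoc (c v) _ _)
                       (first-firing gs P v Q ws≡ (Distinct-mid P (subst Distinct ws≡ dws)))

module Minimal {n : ℕ} (E : ArcSet n) (s : Fin n)
               (loopless : NoLoops E) (eulerian : Eulerian E) (connected : Connected E) where
  open Orders E s loopless eulerian connected public

  -- Otherwise one chip could be removed
  -- from v, keeping the order legal and the configuration stable, hence
  -- recurrent and smaller than c.
  tight : ∀ c → MinimalRecurrent c → ∀ L → Complete L → Legal c L →
    ∀ P v Q → L ≡ P ++ v ∷ Q → c v + received P v ≡ δ v
  tight c ((st , _) , minimal) L cL legal P v Q L≡ = ≤-antisym (≮⇒≥ no-surplus) (legal P v Q L≡)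
    where
    v≢s : v ≢ s
    v≢s = entry-≢ cL L≡
    c⁻ : Config n
    c⁻ w = c w ∸ ind (eqb w v)
    c⁻≤c : c⁻ ≤c c
    c⁻≤c w _ = m∸n≤m (c w) (ind (eqb w v))
    no-surplus : δ v < c v + received P v → ⊥
    no-surplus surplus = 1+n≢n (trans c⁻v≡ (sym (c⁻≈c v v≢s)))
      where
      st⁻ : Stable c⁻
      st⁻ w (w≢s , δ≥1 , enough) = st w (w≢s , δ≥1 , ≤-trans enough (c⁻≤c w w≢s))
      legal⁻ : Legal c⁻ L
      legal⁻ P' w Q' L≡' with w ≟ v
      ... | no _     = legal P' w Q' L≡'
      ... | yes refl rewrite Distinct-split P' P Q' Q (proj₁ cL) L≡' L≡ =
        surplus-∸1 (c w) (received P w) (δ w) surplus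
      c⁻≈c : c⁻ ≈ c
      c⁻≈c = minimal c⁻ (proj₁ (legal-recurrent c⁻ L st⁻ cL legal⁻)) c⁻≤c
      -- c v > 0, since received P v ≤ δ v
      c-pos : 1 ≤ c v
      c-pos = gap-pos (c v) (s≤s received≤δ) (subst (δ v <_) (+-comm (c v) _) surplus)
        where
        received≤δ : received P v ≤ δ v
        received≤δ = ≤-trans (m≤m+n _ (inFrom Q v)) (≤-reflexive (received-split L P v Q cL L≡))
      c⁻v≡ : suc (c⁻ v) ≡ c v
      c⁻v≡ rewrite eqb-refl v = m∸n+n≡m-suc c-pos
        where
        m∸n+n≡m-suc : ∀ {m} → 1 ≤ m → suc (m ∸ 1) ≡ m
        m∸n+n≡m-suc (s≤s _) = refl

  before? : List (Fin n) → Fin n → Fin n → Bool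
  before? []      a b = false
  before? (x ∷ L) a b = (eqb x a ∧ mem L b) ∨ before? L a b

  Before-cons⁻ : ∀ {x L a b} → Before (x ∷ L) a b → (x ≡ a × b ∈ L) ⊎ Before L a b
  Before-cons⁻ ([]      , ys , L≡ , b∈) = let (x≡a , L≡') = ∷-injective L≡ in inj₁ (x≡a , subst (_ ∈_) (sym L≡') b∈)
  Before-cons⁻ ((_ ∷ xs) , ys , L≡ , b∈) = inj₂ (xs , ys , proj₂ (∷-injective L≡) , b∈)

  Before-cons⁺ : ∀ {x L a b} → (x ≡ a × b ∈ L) ⊎ Before L a b → Before (x ∷ L) a b
  Before-cons⁺ {L = L} (inj₁ (refl , b∈L))     = [] , L , refl , b∈L
  Before-cons⁺ {x}     (inj₂ (xs , ys , L≡ , b∈)) = x ∷ xs , ys , cong (x ∷_) L≡ , b∈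

  before?-sound : ∀ L {a b} → before? L a b ≡ true → Before L a b
  before?-sound (x ∷ L) h with ∨-true h
  ... | inj₁ here' = let (x=a , b∈L) = ∧-true here' in Before-cons⁺ (inj₁ (eqb-≡ x=a , mem⇒∈ b∈L))
  ... | inj₂ later = Before-cons⁺ (inj₂ (before?-sound L later))

  before?-complete : ∀ L {a b} → Before L a b → before? L a b ≡ true
  before?-complete []      ([]      , _ , () , _)
  before?-complete []      ((_ ∷ _) , _ , () , _)
  before?-complete (x ∷ L) {a} {b} bf with Before-cons⁻ bf
  ... | inj₁ (refl , b∈L) rewrite eqb-refl x | ∈⇒mem b∈L = refl
  ... | inj₂ bf'          rewrite before?-complete L bf' = ∨-zeroʳ _

  Before-∈ˡ : ∀ {L a b} → Before L a b → a ∈ L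
  Before-∈ˡ (xs , _ , refl , _) = ∈-++⁺ʳ xs (here refl)

  Before-∈ʳ : ∀ {L a b} → Before L a b → b ∈ L
  Before-∈ʳ (xs , _ , refl , b∈) = ∈-++⁺ʳ xs (there b∈)

  Before-split⁺ : ∀ {L P v Q u} → L ≡ P ++ v ∷ Q → u ∈ P → Before L u v
  Before-split⁺ {P = P} {v} {Q} {u} L≡ u∈P =
    let (P₁ , P₂ , P≡) = ∈-∃++ u∈P
    in P₁ , P₂ ++ v ∷ Q ,
       trans L≡ (trans (cong (_++ v ∷ Q) P≡) (++-assoc P₁ (u ∷ P₂) (v ∷ Q))) , ∈-++⁺ʳ P₂ (here refl)

  Before-split⁻ : ∀ {L P v Q u} → Distinct L → L ≡ P ++ v ∷ Q → Before L u v → u ∈ P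
  Before-split⁻ {P = P} {v} {Q} {u} dL L≡ (xs , ys , L≡' , v∈ys) =
    let (ys₁ , ys₂ , ys≡) = ∈-∃++ v∈ys
        L≡'' = trans L≡' (trans (cong (λ z → xs ++ u ∷ z) ys≡) (sym (++-assoc xs (u ∷ ys₁) (v ∷ ys₂))))
    in subst (u ∈_) (sym (Distinct-split P (xs ++ u ∷ ys₁) Q ys₂ dL L≡ L≡'')) (∈-++⁺ʳ xs (here refl))

  graphOf : List (Fin n) → ArcSet n
  graphOf L a b = (eqb a s ∧ (mem L b ∧ E s b)) ∨ (before? L a b ∧ E a b)

  graphOf-sound : ∀ L {a b} → graphOf L a b ≡ true → FGArc L a b
  graphOf-sound L h with ∨-true h
  ... | inj₁ from-s = let (a=s , rest) = ∧-true from-s ; (b∈L , s→b) = ∧-true rest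
                      in inj₁ (eqb-≡ a=s , mem⇒∈ b∈L , s→b)
  ... | inj₂ inner  = let (bf , a→b) = ∧-true inner in inj₂ (before?-sound L bf , a→b)

  graphOf-complete : ∀ L {a b} → FGArc L a b → graphOf L a b ≡ true
  graphOf-complete L {a} (inj₁ (refl , b∈L , s→b)) rewrite eqb-refl a | ∈⇒mem b∈L | s→b = refl
  graphOf-complete L (inj₂ (bf , a→b)) rewrite before?-complete L bf | a→b = ∨-zeroʳ _

  graphOf-iff : ∀ L a b → (graphOf L a b ≡ true) ⇔ FGArc L a b
  graphOf-iff L a b = mk⇔ (graphOf-sound L) (graphOf-complete L)

  represents-graphOf : ∀ (F : ArcSet n) L → (∀ a b → (F a b ≡ true) ⇔ FGArc L a b) → F ≐ graphOf L
  represents-graphOf F L F⇔ a b =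
    bool-ext (graphOf-complete L ∘ Equivalence.to (F⇔ a b)) (Equivalence.from (F⇔ a b) ∘ graphOf-sound L)

  before?-absent : ∀ L {a} b → a ∉ L → before? L a b ≡ false
  before?-absent L {a} b a∉L with before? L a b in bf
  ... | true  = ⊥-elim (a∉L (Before-∈ˡ (before?-sound L bf)))
  ... | false = refl

  graphOf-into : ∀ L P v Q → Complete L → L ≡ P ++ v ∷ Q →
    ∀ u → graphOf L u v ≡ feeds P v u
  graphOf-into L P v Q cL@(dL , s∉L , _) L≡ u with u ≟ s
  ... | yes refl rewrite ∈⇒mem (∈-split L≡) | before?-absent L v s∉L =
    ∨-identityʳ (E u v)
  ... | no _ = cong (_∧ E u v) (bool-ext (λ bf → ∈⇒mem (Before-split⁻ dL L≡ (before?-sound L bf)))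
                                          (λ u∈P → before?-complete L (Before-split⁺ L≡ (mem⇒∈ u∈P))))

  graphOf-indegree : ∀ L P v Q → Complete L → L ≡ P ++ v ∷ Q → size (λ u → graphOf L u v) ≡ received P v
  graphOf-indegree L P v Q cL L≡ = trans (size-ext (graphOf-into L P v Q cL L≡)) (feeds-size cL L≡)

  -- No arc of a firing graph enters the sink, which never fires.
  graphOf-into-sink : ∀ L → Complete L → ∀ a → graphOf L a s ≡ false
  graphOf-into-sink L (_ , s∉L , _) a with graphOf L a s in into-s
  ... | false = refl
  ... | true with graphOf-sound L into-s
  ...   | inj₁ (_ , s∈L , _) = ⊥-elim (s∉L s∈L)
  ...   | inj₂ (bf , _)      = ⊥-elim (s∉L (Before-∈ʳ bf))

  -- Firing graphs are acyclic: arcs strictly increase the rank, which is 0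
  -- at s and 1 + position in L elsewhere.
  position : List (Fin n) → Fin n → ℕ
  position []      v = 0
  position (x ∷ L) v = if eqb x v then 0 else suc (position L v)

  position-later : ∀ {x} L v → x ≢ v → position (x ∷ L) v ≡ suc (position L v)
  position-later L v x≢v rewrite eqb-≢ x≢v = refl

  Before-position : ∀ L {a b} → Distinct L → Before L a b → position L a < position L b
  Before-position []      _ bf with Before-∈ˡ bf
  ... | ()
  Before-position (x ∷ L) {a} {b} (x∉L , dL) bf with Before-cons⁻ bf
  ... | inj₁ (refl , b∈L) rewrite eqb-refl x | position-later L b (λ x≡b → x∉L (subst (_∈ L) (sym x≡b) b∈L)) = s≤s z≤n
  ... | inj₂ bf' rewrite position-later L a (λ x≡a → x∉L (subst (_∈ L) (sym x≡a) (Before-∈ˡ bf')))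
                       | position-later L b (λ x≡b → x∉L (subst (_∈ L) (sym x≡b) (Before-∈ʳ bf'))) =
    s≤s (Before-position L dL bf')

  rank : List (Fin n) → Fin n → ℕ
  rank L v = if eqb v s then 0 else suc (position L v)

  rank-arc : ∀ L {a b} → Complete L → FGArc L a b → rank L a < rank L b
  rank-arc L {a} {b} cL (inj₁ (refl , b∈L , _)) rewrite eqb-refl a | eqb-≢ (Complete-≢ cL b∈L) = s≤s z≤n
  rank-arc L {a} {b} cL (inj₂ (bf , _))
    rewrite eqb-≢ (Complete-≢ cL (Before-∈ˡ bf)) | eqb-≢ (Complete-≢ cL (Before-∈ʳ bf)) =
    s≤s (Before-position L (proj₁ cL) bf)

  firing-graph-acyclic : ∀ (F : ArcSet n) L → Complete L → (∀ a b → F a b ≡ true → FGArc L a b) → Acyclic F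
  firing-graph-acyclic F L cL F⊆ u v u→v path = <⇒≱ (rank-arc L cL (F⊆ u v u→v)) (rank-mono path)
    where
    rank-mono : ∀ {x y} → Star (λ a b → F a b ≡ true) x y → rank L x ≤ rank L y
    rank-mono ε            = ≤-refl
    rank-mono (x→z ◅ path) = ≤-trans (<⇒≤ (rank-arc L cL (F⊆ _ _ x→z))) (rank-mono path)

Path : ∀ {n} → ArcSet n → Fin n → Fin n → Set
Path A = Star (λ a b → A a b ≡ true)

module _ {n : ℕ} (A : ArcSet n) (a b : Fin n) where

  addArc⁻ : ∀ u v → addArc A a b u v ≡ true → (u ≡ a × v ≡ b) ⊎ A u v ≡ true
  addArc⁻ u v h with u ≟ a | v ≟ b
  ... | yes u≡a | yes v≡b = inj₁ (u≡a , v≡b)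
  ... | yes _   | no _    = inj₂ h
  ... | no _    | _       = inj₂ h

  addArc⁺ : ∀ u v → A u v ≡ true → addArc A a b u v ≡ true
  addArc⁺ u v h with u ≟ a | v ≟ b
  ... | yes _ | yes _ = refl
  ... | yes _ | no _  = h
  ... | no _  | _     = h

  addArc-new : addArc A a b a b ≡ true
  addArc-new with a ≟ a | b ≟ b
  ... | yes _   | yes _   = refl
  ... | no a≢a  | _       = ⊥-elim (a≢a refl)
  ... | yes _   | no b≢b  = ⊥-elim (b≢b refl)

  addArc-path : ∀ {x y} → Path (addArc A a b) x y → Path A x y ⊎ (Path A x a × Path A b y)
  addArc-path ε = inj₁ ε
  addArc-path (_◅_ {i = x} {j = z} x→z path) with addArc-path path | addArc⁻ x z x→z
  ... | inj₁ z⇝y          | inj₁ (refl , refl) = inj₂ (ε , z⇝y)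
  ... | inj₁ z⇝y          | inj₂ x→z'          = inj₁ (x→z' ◅ z⇝y)
  ... | inj₂ (_ , b⇝y)    | inj₁ (refl , refl) = inj₂ (ε , b⇝y)
  ... | inj₂ (z⇝a , b⇝y)  | inj₂ x→z'          = inj₂ (x→z' ◅ z⇝a , b⇝y)

  addArc-acyclic : Acyclic A → ¬ Path A b a → Acyclic (addArc A a b)
  addArc-acyclic acyclic no-back u v u→v v⇝u with addArc-path v⇝u | addArc⁻ u v u→v
  ... | inj₁ v⇝u'            | inj₁ (refl , refl) = no-back v⇝u'
  ... | inj₁ v⇝u'            | inj₂ u→v'          = acyclic u v u→v' v⇝u'
  ... | inj₂ (_ , b⇝u)       | inj₁ (refl , refl) = no-back b⇝u
  ... | inj₂ (v⇝a , b⇝u)     | inj₂ u→v'          = no-back (b⇝u ◅◅ (u→v' ◅ v⇝a))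

Path-mono : ∀ {n} {A B : ArcSet n} → A ⊆ₐ B → ∀ {x y} → Path A x y → Path B x y
Path-mono A⊆B ε            = ε
Path-mono A⊆B (x→z ◅ path) = A⊆B _ _ x→z ◅ Path-mono A⊆B path

-- In a maximal acyclic arc set, every missing arc a→b of E is closed into a
-- cycle by a path b ⇝ a (classically; we only need its double negation).
maximal-back-path : ∀ {n} {E A : ArcSet n} → MaximalAcyclic E A →
  ∀ a b → E a b ≡ true → A a b ≡ false → ¬ ¬ Path A b a
maximal-back-path (_ , acyclic , maximal) a b a→b a↛b no-back =
  maximal a b a→b a↛b (addArc-acyclic _ a b acyclic no-back)

module ArcSets {n : ℕ} (E : ArcSet n) (s : Fin n)
               (loopless : NoLoops E) (eulerian : Eulerian E) (connected : Connected E) where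
  open Minimal E s loopless eulerian connected public

  Topological : ArcSet n → List (Fin n) → Set
  Topological A W = ∀ P v Q → W ≡ P ++ v ∷ Q → ∀ u → A u v ≡ true → u ≢ s → u ∈ P

  topological-feeds : ∀ {A W P v Q} → A ⊆ₐ E → Topological A W → W ≡ P ++ v ∷ Q →
    ∀ u → A u v ≡ true → feeds P v u ≡ true
  topological-feeds {A} {W} {P} {v} {Q} A⊆E topo W≡ u u→v with u ≟ s
  ... | yes refl rewrite A⊆E u v u→v = refl
  ... | no u≢s   rewrite ∈⇒mem (topo P v Q W≡ u u→v u≢s) | A⊆E u v u→v = refl

  -- Every acyclic arc set has a complete topological order: repeatedly
  -- place an unplaced non-sink vertex without unplaced in-neighbours.
  module TopologicalSort (A : ArcSet n) (acyclic : Acyclic A) where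

    Unplaced : (Fin n → Bool) → Fin n → Bool
    Unplaced placed u = not (placed u) ∧ not (eqb u s)

    Source : (Fin n → Bool) → Fin n → Set
    Source placed v = Unplaced placed v ≡ true × (∀ u → A u v ≡ true → Unplaced placed u ≡ false)

    -- Walk backwards from cur along unplaced in-neighbours.  The walk
    -- cur ∷ L never repeats a vertex (that would close a cycle), so it
    -- ends at a source within n steps.
    find-source : ∀ placed fuel cur L → Unplaced placed cur ≡ true → Distinct (cur ∷ L) →
      (∀ x → x ∈ cur ∷ L → Path A cur x) → n < fuel + length (cur ∷ L) → Σ (Fin n) (Source placed)
    find-source placed zero cur L _ dL _ bound = ⊥-elim (<⇒≱ bound (Distinct-length (cur ∷ L) dL))
    find-source placed (suc fuel) cur L cur-ok dL reach bound
      with size (λ u → A u cur ∧ Unplaced placed u) in preds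
    ... | zero  = cur , cur-ok , λ u u→cur → no-pred u u→cur (size-empty⁻ _ preds u)
      where
      no-pred : ∀ u → A u cur ≡ true → A u cur ∧ Unplaced placed u ≡ false → Unplaced placed u ≡ false
      no-pred u u→cur h rewrite u→cur = h
    ... | suc _ = walk-on (size-witness (λ u → A u cur ∧ Unplaced placed u) (subst (1 ≤_) (sym preds) (s≤s z≤n)))
      where
      walk-on : (Σ (Fin n) λ u → A u cur ∧ Unplaced placed u ≡ true) → Σ (Fin n) (Source placed)
      walk-on (u , h) with ∧-true {A u cur} h | mem (cur ∷ L) u in visited
      ... | (u→cur , u-ok) | true  = ⊥-elim (acyclic u cur u→cur (reach u (mem⇒∈ visited)))
      ... | (u→cur , u-ok) | false =
        find-source placed fuel u (cur ∷ L) u-ok (∉-walk , dL)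
          (λ { x (here refl) → ε ; x (there x∈) → u→cur ◅ reach x x∈ })
          (subst (n <_) (sym (+-suc fuel (length (cur ∷ L)))) bound)
        where
        ∉-walk : u ∉ cur ∷ L
        ∉-walk u∈ with trans (sym (∈⇒mem u∈)) visited
        ... | ()

    Sorted : (Fin n → Bool) → List (Fin n) → Set
    Sorted placed W = Distinct W × (∀ x → x ∈ W → Unplaced placed x ≡ true) ×
      (∀ v → Unplaced placed v ≡ true → v ∈ W) ×
      (∀ P v Q → W ≡ P ++ v ∷ Q → ∀ u → A u v ≡ true → u ≢ s → placed u ≡ true ⊎ u ∈ P)

    mark : (Fin n → Bool) → Fin n → Fin n → Bool
    mark placed x u = placed u ∨ eqb u x

    unplaced-mark : ∀ placed x u → Unplaced (mark placed x) u ≡ true → Unplaced placed u ≡ true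
    unplaced-mark placed x u h with placed u | eqb u x
    ... | false | false = h

    mark-shrinks : ∀ placed x → Unplaced placed x ≡ true →
      suc (size (Unplaced (mark placed x))) ≤ size (Unplaced placed)
    mark-shrinks placed x x-ok = size-strict _ _ x (unplaced-mark placed x) x-marked x-ok
      where
      x-marked : Unplaced (mark placed x) x ≡ false
      x-marked rewrite eqb-refl x | ∨-zeroʳ (placed x) = refl

    place-source : ∀ placed x W → Source placed x → Sorted (mark placed x) W → Sorted placed (x ∷ W)
    place-source placed x W (x-ok , x-source) (dW , W-ok , W-all , W-sorted) =
      ((λ x∈W → x-not-in (W-ok x x∈W)) , dW) ,
      (λ { y (here refl) → x-ok ; y (there y∈W) → unplaced-mark placed x y (W-ok y y∈W) }) ,
      all ,
      sorted
      where
      x-not-in : Unplaced (mark placed x) x ≡ true → ⊥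
      x-not-in h rewrite eqb-refl x | ∨-zeroʳ (placed x) with h
      ... | ()
      all : ∀ v → Unplaced placed v ≡ true → v ∈ x ∷ W
      all v v-ok with v ≟ x
      ... | yes refl = here refl
      ... | no v≢x   = there (W-all v (subst (λ b → not b ∧ not (eqb v s) ≡ true)
                                             (sym (trans (cong (placed v ∨_) (eqb-≢ v≢x)) (∨-identityʳ _))) v-ok))
      sorted : ∀ P v Q → x ∷ W ≡ P ++ v ∷ Q → ∀ u → A u v ≡ true → u ≢ s → placed u ≡ true ⊎ u ∈ P
      sorted [] v Q eq u u→v u≢s with ∷-injective eq
      ... | (refl , _) = inj₁ (placed-pred (x-source u u→v))
        where
        placed-pred : Unplaced placed u ≡ false → placed u ≡ true
        placed-pred h rewrite eqb-≢ u≢s with placed u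
        ... | true = refl
        placed-pred () | false
      sorted (y ∷ P) v Q eq u u→v u≢s with ∷-injective eq
      ... | (refl , W≡) with W-sorted P v Q W≡ u u→v u≢s
      ...   | inj₂ u∈P = inj₂ (there u∈P)
      ...   | inj₁ h with ∨-true {placed u} h
      ...     | inj₁ placed-u = inj₁ placed-u
      ...     | inj₂ u=x      = inj₂ (here (eqb-≡ u=x))

    sort : ∀ k placed → size (Unplaced placed) ≤ k → Σ (List (Fin n)) (Sorted placed)
    sort k placed bound with size (Unplaced placed) in remaining
    ... | zero = [] , tt , (λ _ ()) ,
                 (λ v v-ok → ⊥-elim (<⇒≢ (size-pos v v-ok) (sym remaining))) ,
                 (λ { [] _ _ () ; (_ ∷ _) _ _ () })
    sort zero    placed bound | suc _ = ⊥-elim (<⇒≱ (s≤s z≤n) bound)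
    sort (suc k) placed bound | suc _ =
      place (size-witness (Unplaced placed) (subst (1 ≤_) (sym remaining) (s≤s z≤n)))
      where
      place : (Σ (Fin n) λ v → Unplaced placed v ≡ true) → Σ (List (Fin n)) (Sorted placed)
      place (v₀ , v₀-ok) =
        let (x , source) = find-source placed n v₀ [] v₀-ok ((λ ()) , tt) (λ { y (here refl) → ε })
                                       (subst (n <_) (+-comm 1 n) ≤-refl)
            bound' = s≤s⁻¹ (≤-trans (mark-shrinks placed x (proj₁ source)) (≤-trans (≤-reflexive remaining) bound))
            (W , sorted) = sort k (mark placed x) bound'
        in x ∷ W , place-source placed x W source sorted

    topological-order : Σ (List (Fin n)) λ W → Complete W × Topological A W
    topological-order =
      let (W , dW , W-ok , W-all , W-sorted) = sort n (λ _ → false) (size-≤ _)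
      in W , (dW , (λ s∈W → s-unplaced (W-ok s s∈W)) , (λ v v≢s → W-all v (nonsink-unplaced v≢s))) ,
         λ P v Q W≡ u u→v u≢s → never-placed (W-sorted P v Q W≡ u u→v u≢s)
      where
      s-unplaced : not (eqb s s) ≡ true → ⊥
      s-unplaced h rewrite eqb-refl s with h
      ... | ()
      nonsink-unplaced : ∀ {v} → v ≢ s → not (eqb v s) ≡ true
      nonsink-unplaced v≢s rewrite eqb-≢ v≢s = refl
      never-placed : ∀ {u P} → false ≡ true ⊎ u ∈ P → u ∈ P
      never-placed (inj₂ u∈P) = u∈P

  module Consistency (A : ArcSet n) (maximal : MaximalAcyclic E A) (no-into-s : ∀ u → A u s ≡ false)
                     (W : List (Fin n)) (cW : Complete W) where

    A⊆E : A ⊆ₐ E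
    A⊆E = proj₁ maximal

    arc-target-≢ : ∀ {x y} → A x y ≡ true → y ≢ s
    arc-target-≢ {x} x→y refl with trans (sym x→y) (no-into-s x)
    ... | ()

    no-path-to-s : ∀ {x} → Path A x s → x ≢ s → ⊥
    no-path-to-s ε                   x≢s = x≢s refl
    no-path-to-s (_◅_ {j = y} x→y path) _ = no-path-to-s path (arc-target-≢ x→y)

    PredClosed : List (Fin n) → Set
    PredClosed P = ∀ u x → A u x ≡ true → u ≢ s → x ∈ P → u ∈ P

    closed-path : ∀ {P x y} → PredClosed P → Path A x y → x ≢ s → y ∈ P → x ∈ P
    closed-path closed ε                x≢s y∈P = y∈P
    closed-path closed (x→z ◅ path)     x≢s y∈P =
      closed _ _ x→z x≢s (closed-path closed path (arc-target-≢ x→z) y∈P)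

    ForwardBelow : ℕ → Set
    ForwardBelow k = ∀ P v Q → W ≡ P ++ v ∷ Q → length P < k → ∀ u → A u v ≡ true → u ≢ s → u ∈ P

    prefix-closed : ∀ {P v Q} → ForwardBelow (length P) → W ≡ P ++ v ∷ Q → PredClosed P
    prefix-closed {P} {v} {Q} forward W≡ u x u→x u≢s x∈P =
      let (P₁ , P₂ , P≡) = ∈-∃++ x∈P
          W≡' = trans W≡ (trans (cong (_++ v ∷ Q) P≡) (++-assoc P₁ (x ∷ P₂) (v ∷ Q)))
          shorter : length P₁ < length P
          shorter = subst (length P₁ <_) (trans (sym (length-++ P₁)) (cong length (sym P≡)))
                          (m<m+n (length P₁) (s≤s z≤n))
      in subst (u ∈_) (sym P≡) (∈-++⁺ˡ (forward P₁ x (P₂ ++ v ∷ Q) W≡' shorter u u→x u≢s))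

    -- If W is topological before v, every vertex feeding v is an
    -- A-in-neighbour of v: a missing arc w→v would be closed into a cycle
    -- by a path v ⇝ w, which cannot end at s or in the prefix before v.
    feeders-in-A : ∀ {P v Q} → ForwardBelow (length P) → W ≡ P ++ v ∷ Q →
      ∀ w → feeds P v w ≡ true → A w v ≡ true
    feeders-in-A {P} {v} {Q} forward W≡ w feeds-w with A w v in w→v
    ... | true  = refl
    ... | false = ⊥-elim (maximal-back-path maximal w v (proj₂ (∧-true feeds-w)) w→v back)
      where
      v∉P : v ∉ P
      v∉P = Distinct-mid P (subst Distinct W≡ (proj₁ cW))
      v≢s : v ≢ s
      v≢s = entry-≢ cW W≡
      back : ¬ Path A v w
      back v⇝w with ∨-true (proj₁ (∧-true feeds-w))
      ... | inj₁ w=s = no-path-to-s (subst (Path A v) (eqb-≡ w=s) v⇝w) v≢s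
      ... | inj₂ w∈P = v∉P (closed-path (prefix-closed forward W≡) v⇝w v≢s (mem⇒∈ w∈P))

    -- Under the in-degree bound, counting shows the converse: the
    -- A-in-neighbours of v are exactly its feeders.
    forward-step : ∀ {P v Q} → size (λ u → A u v) ≤ received P v → ForwardBelow (length P) →
      W ≡ P ++ v ∷ Q → ∀ u → A u v ≡ true → u ≢ s → u ∈ P
    forward-step {P} {v} {Q} bound forward W≡ u u→v u≢s =
      from-feeds (size-⊆-≥ (feeders-in-A forward W≡) bound' u u→v)
      where
      from-feeds : feeds P v u ≡ true → u ∈ P
      from-feeds h with ∨-true (proj₁ (∧-true h))
      ... | inj₁ u=s = ⊥-elim (u≢s (eqb-≡ u=s))
      ... | inj₂ u∈P = mem⇒∈ u∈P
      bound' : size (λ u → A u v) ≤ size (feeds P v)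
      bound' = subst (size (λ u → A u v) ≤_) (sym (feeds-size cW W≡)) bound

    topological-by-count : (∀ P v Q → W ≡ P ++ v ∷ Q → size (λ u → A u v) ≤ received P v) → Topological A W
    topological-by-count bound P v Q W≡ = forward-below (suc (length P)) P v Q W≡ ≤-refl
      where
      forward-below : ∀ k → ForwardBelow k
      forward-below (suc k) P' v' Q' W≡' (s≤s |P'|≤k) with m≤n⇒m<n∨m≡n |P'|≤k
      ... | inj₁ |P'|<k = forward-below k P' v' Q' W≡' |P'|<k
      ... | inj₂ |P'|≡k =
        forward-step (bound P' v' Q' W≡') (subst ForwardBelow (sym |P'|≡k) (forward-below k)) W≡'

    firing-graph-of-topological : Topological A W → A ≐ graphOf W
    firing-graph-of-topological topo a b with b ≟ s
    ... | yes refl = trans (no-into-s a) (sym (graphOf-into-sink W cW a))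
    ... | no b≢s =
      let (P , Q , W≡) = ∈-∃++ (proj₂ (proj₂ cW) b b≢s)
      in trans (bool-ext (topological-feeds A⊆E topo W≡ a) (feeders-in-A (λ P' v Q' W≡' _ → topo P' v Q' W≡') W≡ a))
               (sym (graphOf-into W P b Q cW W≡ a))

module Bijection {n : ℕ} (E : ArcSet n) (s : Fin n)
                 (loopless : NoLoops E) (eulerian : Eulerian E) (connected : Connected E) where
  open ArcSets E s loopless eulerian connected public

  module FiringGraphOf (c : Config n) (minimal : MinimalRecurrent c) (F : ArcSet n)
                       (ws : List (Fin n)) (burn : FiresTo (c ⊕ β) ws c)
                       (F⇔ : ∀ a b → (F a b ≡ true) ⇔ FGArc ws a b) where

    stable : Stable c
    stable = proj₁ (proj₁ minimal)

    complete : Complete ws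
    complete = proj₁ (burning-legal c (proj₁ minimal) burn)

    F≐ : F ≐ graphOf ws
    F≐ = represents-graphOf F ws F⇔

    F⊆E : F ⊆ₐ E
    F⊆E a b a→b with Equivalence.to (F⇔ a b) a→b
    ... | inj₁ (refl , _ , s→b) = s→b
    ... | inj₂ (_ , a→b')       = a→b'

    -- c v + indeg_F v = δ v, by tightness of the legal order ws.
    indegree : ∀ v → v ≢ s → c v + size (λ u → F u v) ≡ δ v
    indegree v v≢s =
      let (P , Q , ws≡) = ∈-∃++ (proj₂ (proj₂ complete) v v≢s)
      in trans (cong (c v +_) (trans (size-ext (λ u → F≐ u v)) (graphOf-indegree ws P v Q complete ws≡)))
               (tight c minimal ws complete (proj₂ (burning-legal c (proj₁ minimal) burn)) P v Q ws≡)

    indegree-pos : ∀ v → v ≢ s → 1 ≤ size (λ u → F u v)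
    indegree-pos v v≢s = gap-pos _ (stable-below stable v≢s) (≤-reflexive (sym (indegree v v≢s)))

    no-into-s : ∀ u → F u s ≡ false
    no-into-s u = trans (F≐ u s) (graphOf-into-sink ws complete u)

    -- Every non-sink vertex has an F-in-neighbour that is s or fired
    -- earlier, so s reaches every vertex in F.
    paths-from-s : ∀ v → v ≢ s → Path F s v
    paths-from-s v v≢s = reach-along _ s ws pred v (proj₂ (proj₂ complete) v v≢s)
      where
      pred : ∀ P v Q → ws ≡ P ++ v ∷ Q → Σ (Fin n) λ u → F u v ≡ true × (u ≡ s ⊎ u ∈ P)
      pred P v Q ws≡ =
        let v≢s = entry-≢ complete ws≡
            (u , u→v) = size-witness (λ u → F u v) (indegree-pos v v≢s)
            feeds-u = trans (sym (graphOf-into ws P v Q complete ws≡ u)) (trans (sym (F≐ u v)) u→v)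
        in u , u→v , from-feeds (∨-true (proj₁ (∧-true feeds-u)))
        where
        from-feeds : ∀ {u} → eqb u s ≡ true ⊎ mem P u ≡ true → u ≡ s ⊎ u ∈ P
        from-feeds (inj₁ u=s) = inj₁ (eqb-≡ u=s)
        from-feeds (inj₂ u∈P) = inj₂ (mem⇒∈ u∈P)

    -- Maximality, main case: if F + a→b is acyclic with b ≠ s, a
    -- topological order W of F + a→b is legal for c, hence tight at b; but
    -- b has strictly more feeders in W than F-in-neighbours, a being one.
    no-missing-arc : ∀ a b → E a b ≡ true → F a b ≡ false → b ≢ s →
      (Σ (List (Fin n)) λ W → Complete W × Topological (addArc F a b) W) → ⊥
    no-missing-arc a b a→b a↛b b≢s (W , cW , topo) with ∈-∃++ (proj₂ (proj₂ cW) b b≢s)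
    ... | (P , Q , W≡) = <⇒≢ more-feeders (+-cancelˡ-≡ (c b) _ _ (trans (indegree b b≢s) (sym tight-b)))
      where
      F⁺⊆E : addArc F a b ⊆ₐ E
      F⁺⊆E u v u→v with addArc⁻ F a b u v u→v
      ... | inj₁ (refl , refl) = a→b
      ... | inj₂ u→v'          = F⊆E u v u→v'
      F-feeds : ∀ {P v Q} → W ≡ P ++ v ∷ Q → ∀ u → F u v ≡ true → feeds P v u ≡ true
      F-feeds W≡ u u→v = topological-feeds F⁺⊆E topo W≡ u (addArc⁺ F a b u _ u→v)
      legal : Legal c W
      legal P v Q W≡ = begin
        δ v                            ≡⟨ indegree v (entry-≢ cW W≡) ⟨
        c v + size (λ u → F u v)       ≤⟨ +-monoʳ-≤ (c v) (size-mono (F-feeds W≡)) ⟩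
        c v + size (feeds P v)         ≡⟨ cong (c v +_) (feeds-size cW W≡) ⟩
        c v + received P v             ∎
        where open ≤-Reasoning
      tight-b : c b + received P b ≡ δ b
      tight-b = tight c minimal W cW legal P b Q W≡
      more-feeders : size (λ u → F u b) < received P b
      more-feeders = subst (size (λ u → F u b) <_) (feeds-size cW W≡)
        (size-strict (λ u → F u b) (feeds P b) a (F-feeds W≡) a↛b
                     (topological-feeds F⁺⊆E topo W≡ a (addArc-new F a b)))

    -- An arc a→s would close a cycle with a path s ⇝ a.
    maximal : ∀ a b → E a b ≡ true → F a b ≡ false → ¬ Acyclic (addArc F a b)
    maximal a b a→b a↛b acyclic⁺ with b ≟ s
    ... | yes refl = acyclic⁺ a s (addArc-new F a s) (Path-mono (addArc⁺ F a s) (paths-from-s a a≢s))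
      where
      a≢s : a ≢ s
      a≢s refl = true≢false (trans (sym a→b) (loopless s))
    ... | no b≢s   = no-missing-arc a b a→b a↛b b≢s (TopologicalSort.topological-order (addArc F a b) acyclic⁺)

    in-𝒜 : InAcal E s F
    in-𝒜 = (F⊆E , firing-graph-acyclic F ws complete (λ a b → Equivalence.to (F⇔ a b)) , maximal) ,
           trans (count≡size (λ u → F u s)) (size-empty no-into-s) ,
           λ v v≢s indeg≡0 → <⇒≢ (indegree-pos v v≢s) (sym (trans (sym (count≡size (λ u → F u v))) indeg≡0))

  -- The firing graph of a minimal recurrent c is unique: take the one of a
  -- legal order L; for any other firing sequence ws, tightness makes the
  -- in-degrees of graphOf L match the chips received along ws, so by
  -- Consistency graphOf L is also the firing graph of ws.
  unique-firing-graph : ∀ c → MinimalRecurrent c →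
    Σ (ArcSet n) λ F → IsFiringGraph c F × (∀ F' → IsFiringGraph c F' → F' ≐ F)
  unique-firing-graph c minimal with recurrent-legal-order c (proj₁ minimal)
  ... | (L , cL , legalL) = graphOf L , (L , burn , graphOf-iff L) , unique
    where
    burn : FiresTo (c ⊕ β) L c
    burn = legal-fires c L cL legalL
    module F₀ = FiringGraphOf c minimal (graphOf L) L burn (graphOf-iff L)
    unique : ∀ F' → IsFiringGraph c F' → F' ≐ graphOf L
    unique F' (ws , burn' , F'⇔) a b with burning-legal c (proj₁ minimal) burn'
    ... | (cws , legal) =
      trans (represents-graphOf F' ws F'⇔ a b) (sym (C.firing-graph-of-topological (C.topological-by-count bound) a b))
      where
      module C = Consistency (graphOf L) (proj₁ F₀.in-𝒜) F₀.no-into-s ws cws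
      bound : ∀ P v Q → ws ≡ P ++ v ∷ Q → size (λ u → graphOf L u v) ≤ received P v
      bound P v Q ws≡ = ≤-reflexive (+-cancelˡ-≡ (c v) _ _
        (trans (F₀.indegree v (entry-≢ cws ws≡))
               (sym (tight c minimal ws cws legal P v Q ws≡))))

  -- c is recovered from its firing graph: c v = δ v − indeg_F v.
  determined-by-firing-graph : ∀ c c' F F' → MinimalRecurrent c → MinimalRecurrent c' →
    IsFiringGraph c F → IsFiringGraph c' F' → F ≐ F' → c ≈ c'
  determined-by-firing-graph c c' F F' minimal minimal' (ws , burn , F⇔) (ws' , burn' , F'⇔) F≐F' v v≢s =
    +-cancelʳ-≡ (size (λ u → F u v)) (c v) (c' v) (begin
      c v + size (λ u → F u v)      ≡⟨ G.indegree v v≢s ⟩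
      δ v                           ≡⟨ G'.indegree v v≢s ⟨
      c' v + size (λ u → F' u v)    ≡⟨ cong (c' v +_) (size-ext (λ u → F≐F' u v)) ⟨
      c' v + size (λ u → F u v)     ∎)
    where
    open ≡-Reasoning
    module G  = FiringGraphOf c  minimal  F  ws  burn  F⇔
    module G' = FiringGraphOf c' minimal' F' ws' burn' F'⇔

  -- Every A ∈ 𝒜 is the firing graph of the minimal recurrent configuration
  -- c v = δ v − indeg_A v.
  module Realisation (A : ArcSet n) (A∈𝒜 : InAcal E s A) where

    maximal : MaximalAcyclic E A
    maximal = proj₁ A∈𝒜

    no-into-s : ∀ u → A u s ≡ false
    no-into-s = size-empty⁻ (λ u → A u s) (trans (sym (count≡size (λ u → A u s))) (proj₁ (proj₂ A∈𝒜)))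

    indegA : Fin n → ℕ
    indegA v = size (λ u → A u v)

    indegA-pos : ∀ v → v ≢ s → 0 < indegA v
    indegA-pos v v≢s with indegA v in eq
    ... | zero  = ⊥-elim (proj₂ (proj₂ A∈𝒜) v v≢s (trans (count≡size (λ u → A u v)) eq))
    ... | suc _ = s≤s z≤n

    indegA≤δ : ∀ v → indegA v ≤ δ v
    indegA≤δ v = subst (indegA v ≤_) (sym (δ≡size-in v)) (size-mono (λ u → proj₁ maximal u v))

    c : Config n
    c v = δ v ∸ indegA v

    c+indegA : ∀ v → c v + indegA v ≡ δ v
    c+indegA v = m∸n+n≡m (indegA≤δ v)

    stable : Stable c
    stable v (v≢s , _ , enough) = <⇒≱ (∸-monoʳ-< {o = 0} (indegA-pos v v≢s) (indegA≤δ v)) enough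

    indeg-received : ∀ {L} → Complete L → A ≐ graphOf L → ∀ P v Q → L ≡ P ++ v ∷ Q → indegA v ≡ received P v
    indeg-received {L} cL A≐ P v Q L≡ = trans (size-ext (λ u → A≐ u v)) (graphOf-indegree L P v Q cL L≡)

    legal : ∀ {L} → Complete L → A ≐ graphOf L → Legal c L
    legal cL A≐ P v Q L≡ = ≤-reflexive (trans (sym (c+indegA v)) (cong (c v +_) (indeg-received cL A≐ P v Q L≡)))

    -- A recurrent c' ≤ c has a legal order L, along which no vertex has
    -- more A-in-neighbours than chips received; so by Consistency A is the
    -- firing graph of L, and legality of L for c' gives c ≤ c'.
    minimality : ∀ c' → Recurrent c' → c' ≤c c → c' ≈ c
    minimality c' recurrent' c'≤c v v≢s with recurrent-legal-order c' recurrent'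
    ... | (L , cL , legal') = ≤-antisym (c'≤c v v≢s) c≤c'
      where
      bound : ∀ P v Q → L ≡ P ++ v ∷ Q → indegA v ≤ received P v
      bound P v Q L≡ = +-cancelˡ-≤ (c v) _ _ (begin
        c v + indegA v         ≡⟨ c+indegA v ⟩
        δ v                    ≤⟨ legal' P v Q L≡ ⟩
        c' v + received P v    ≤⟨ +-monoˡ-≤ _ (c'≤c v (entry-≢ cL L≡)) ⟩
        c v + received P v     ∎)
        where open ≤-Reasoning
      module C = Consistency A maximal no-into-s L cL
      A≐L : A ≐ graphOf L
      A≐L = C.firing-graph-of-topological (C.topological-by-count bound)
      c≤c' : c v ≤ c' v
      c≤c' with ∈-∃++ (proj₂ (proj₂ cL) v v≢s)
      ... | (P , Q , L≡) = begin
        δ v ∸ indegA v                      ≤⟨ ∸-monoˡ-≤ (indegA v) (legal' P v Q L≡) ⟩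
        (c' v + received P v) ∸ indegA v    ≡⟨ cong (λ k → (c' v + k) ∸ indegA v) (indeg-received cL A≐L P v Q L≡) ⟨
        (c' v + indegA v) ∸ indegA v        ≡⟨ m+n∸n≡m (c' v) (indegA v) ⟩
        c' v                                ∎
        where open ≤-Reasoning

  -- A topological order W of A is a legal order for c with firing graph A.
  realise : ∀ A → InAcal E s A → Σ (Config n) λ c → MinimalRecurrent c × IsFiringGraph c A
  realise A A∈𝒜 with TopologicalSort.topological-order A (proj₁ (proj₂ (proj₁ A∈𝒜)))
  ... | (W , cW , topo) =
    R.c , (proj₁ burning , R.minimality) , (W , proj₂ burning , A⇔)
    where
    module R = Realisation A A∈𝒜
    A≐ : A ≐ graphOf W
    A≐ = Consistency.firing-graph-of-topological A R.maximal R.no-into-s W cW topo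
    A⇔ : ∀ a b → (A a b ≡ true) ⇔ FGArc W a b
    A⇔ a b = mk⇔ (λ a→b → graphOf-sound W (trans (sym (A≐ a b)) a→b))
                 (λ arc → trans (A≐ a b) (graphOf-complete W arc))
    burning : Recurrent R.c × FiresTo (R.c ⊕ β) W R.c
    burning = legal-recurrent R.c W R.stable cW (R.legal cW A≐)

theorem3 : ∀ {n : ℕ} (E : ArcSet n) (s : Fin n) →
    NoLoops E → Connected E → Eulerian E →
    let open Chip E s in
    -- every minimal recurrent c has exactly one firing graph
    (∀ c → MinimalRecurrent c →
      Σ (ArcSet n) λ F → IsFiringGraph c F ×
        (∀ F' → IsFiringGraph c F' → F' ≐ F)) ×
    -- the map c ↦ arc set of F_c lands in 𝒜
    (∀ c F → MinimalRecurrent c → IsFiringGraph c F → InAcal E s F) ×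
    -- injective
    (∀ c c' F F' → MinimalRecurrent c → MinimalRecurrent c' →
      IsFiringGraph c F → IsFiringGraph c' F' → F ≐ F' → c ≈ c') ×
    -- surjective
    (∀ A → InAcal E s A →
      Σ (Config n) λ c → MinimalRecurrent c × IsFiringGraph c A)
theorem3 E s loopless connected eulerian =
  unique-firing-graph ,
  (λ c F minimal (ws , burn , F⇔) → FiringGraphOf.in-𝒜 c minimal F ws burn F⇔) ,
  determined-by-firing-graph ,
  realise
  where open Bijection E s loopless eulerian connected
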